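{- Let $q$ be a power of an odd prime $p$, and let $e\ge 2$ and $a$ be integers with $2\le a\le pe-2$, $\gcd(a,pe)=1$ and $a+2\le e<2a$. Let $0<r<q$ and $s>0$ be integers with $s\equiv -r\pmod{q-1}$ and $2s\equiv r\pmod q$. Put $N=rq^{e-a}+s$ and $S_2=2rq^{e-a-1}+q^{ -1}(2s-r)$. If $s\le q^{e-a-1}(q-1)$, then $0<N<q^e-1$ and \[ C(N)=\sum_{\alpha_{2i}}\binom{s}{\alpha_{21},\dots,\alpha_{2a}}, \] the sum being over all nonnegative integers $\alpha_{2i}$ ($1\le i\le a$) with $\sum_{i=1}^a\alpha_{2i}=s$ and $\sum_{i=1}^a\alpha_{2i}q^{i-1}=S_2$.
   Context: $f_{a,q}=X^{q-2}+X^{q^2-2}+\cdots+X^{q^a-2}\in\mathbb{F}_q[X]$. For an integer $N\ge0$, $C(N)\in\mathbb{F}_q$ is the coefficient of $X^{q^e-1}$ in the remainder of $f_{a,q}^N$ upon division by $X^{q^e}-X$. Integers are regarded as elements of $\mathbb{F}_q$ via reduction modulo $p$. Multinomial coefficients $\binom{n}{n_1,\dots,n_k}=n!/(n_1!\cdots n_k!)$ when $\sum n_i=n$, and $0$ otherwise. -}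

module Defs where

open import Data.Nat using (ℕ; zero; suc; _+_; _*_; _∸_; _^_; _≤_; _<_; NonZero; _≡ᵇ_; _/_; _%_; _!)
open import Data.Nat.Properties using (m*n≢0; _!≢0)

open import Data.List using (List; []; _∷_; _++_; [_]; replicate; map; concatMap; filter; upTo; length; foldr)
open import Data.Vec as V using (Vec; []; _∷_)
open import Data.Bool using (Bool; _∧_; true; false; if_then_else_)
open import Data.Product using (Σ; _×_; ∃)
open import Relation.Binary.PropositionalEquality using (_≡_)
open import Relation.Nullary.Decidable using (Dec)
open import Data.Bool.Properties using (T?)
open import Data.Bool using (T)

-- Polynomials with natural-number coefficients, as coefficient lists
-- (index = degree).  Coefficients are later compared modulo p, so this
-- models polynomials over the prime field F_p ⊆ F_q.

Poly : Set
Poly = List ℕ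

coeff : Poly → ℕ → ℕ
coeff []       _       = 0
coeff (c ∷ _)  zero    = c
coeff (_ ∷ cs) (suc k) = coeff cs k

infixl 6 _⊕_
infixl 7 _⊗_

_⊕_ : Poly → Poly → Poly
[]       ⊕ B        = B
(a ∷ A)  ⊕ []       = a ∷ A
(a ∷ A)  ⊕ (b ∷ B)  = (a + b) ∷ (A ⊕ B)

_⊗_ : Poly → Poly → Poly
[]      ⊗ B = []
(c ∷ A) ⊗ B = map (c *_) B ⊕ (0 ∷ (A ⊗ B))

mon : ℕ → Poly
mon n = replicate n 0 ++ [ 1 ]

_^ₚ_ : Poly → ℕ → Poly
A ^ₚ zero  = [ 1 ]
A ^ₚ suc n = A ⊗ (A ^ₚ n)

_≈[_]_ : Poly → (p : ℕ) → .{{NonZero p}} → Poly → Set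
A ≈[ p ] B = ∀ k → coeff A k % p ≡ coeff B k % p

fPoly : (a q : ℕ) → Poly
fPoly zero    q = []
fPoly (suc a) q = fPoly a q ⊕ mon (q ^ suc a ∸ 2)

-- R is the remainder of A upon division by X^n - X in F_p[X]:
-- deg R < n and A = Q (X^n - X) + R for some Q, written without
-- subtraction as  A + Q·X = Q·X^n + R  (mod p).
IsRemainder : (p : ℕ) → .{{NonZero p}} → (n : ℕ) → Poly → Poly → Set
IsRemainder p n A R =
  length R ≤ n × ∃ λ (Q : Poly) → (A ⊕ Q ⊗ mon 1) ≈[ p ] (Q ⊗ mon n ⊕ R)

-- "C(N) = c in F_q": the coefficient of X^{q^e-1} in the remainder of
-- f_{a,q}^N upon division by X^{q^e}-X equals c modulo p.
-- (The remainder is unique, so we quantify over all remainders.)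
CIs : (p q e a N : ℕ) → .{{NonZero p}} → ℕ → Set
CIs p q e a N c =
  ∀ (R : Poly) → IsRemainder p (q ^ e) (fPoly a q ^ₚ N) R →
    coeff R (q ^ e ∸ 1) % p ≡ c % p

prodFact : List ℕ → ℕ
prodFact []       = 1
prodFact (x ∷ xs) = x ! * prodFact xs

prodFact≢0 : ∀ xs → NonZero (prodFact xs)
prodFact≢0 []       = _
prodFact≢0 (x ∷ xs) = m*n≢0 (x !) (prodFact xs) {{x !≢0}} {{prodFact≢0 xs}}

sumL : List ℕ → ℕ
sumL = foldr _+_ 0

multinomial : ℕ → List ℕ → ℕ
multinomial n xs =
  if sumL xs ≡ᵇ n then (n ! / prodFact xs) {{prodFact≢0 xs}} else 0

boxVecs : (a s : ℕ) → List (Vec ℕ a)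
boxVecs zero    s = [ [] ]
boxVecs (suc a) s = concatMap (λ x → map (x ∷_) (boxVecs a s)) (upTo (suc s))

weightedSum : (q : ℕ) → {a : ℕ} → Vec ℕ a → ℕ
weightedSum q []       = 0
weightedSum q (x ∷ xs) = x + q * weightedSum q xs

-- Σ over α ∈ ℕ^a with Σ α_i = s and Σ α_i q^{i-1} = S of multinomial s α
-- (entries of such α are automatically ≤ s, so the box enumeration
--  covers all of them)
multinomialSum : (q a s S : ℕ) → ℕ
multinomialSum q a s S =
  sumL (map (λ α → multinomial s (V.toList α))
            (filter (λ α → T? ((V.sum α ≡ᵇ s) ∧ (weightedSum q α ≡ᵇ S)))
                    (boxVecs a s)))

module Submission where

-- A polynomial with natural coefficients is represented by the list of its
-- exponents, compared through pairings Σ_{x ∈ L} h x with test functions h;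
-- these lists form a commutative semiring, so the library's binomial theorem
-- applies.  The proof then runs as follows.
--  * Frobenius: L^p ≡ L(X^p) modulo p, hence f^N ≡ f(X^Q)^r · f^s with
--    Q = q^{e-a} a power of p.
--  * The multinomial theorem expands both factors into monomials
--    X^{β·cᴿ + α·cˢ}, weighted by multinomial coefficients.
--  * Reducing modulo X^{q^e} - X, the top coefficient of the remainder is the
--    sum of the coefficients at the positive multiples of M = q^e - 1.
--  * A base-q estimate (module MultipleOfM) shows that β·cᴿ + α·cˢ is such a
--    multiple exactly when β = (r,0,…,0) and Σ α_i q^{i-1} = S₂.

open import Defs
open import Data.Nat using (ℕ; zero; suc; _+_; _*_; _∸_; _^_; _%_; _/_; NonZero; _≤_; _<_; s≤s; z≤n; s≤s⁻¹; _!; _≡ᵇ_; _≟_; _≤?_; >-nonZero)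
open import Data.Nat.Base using (nonTrivial⇒n>1)
open import Data.Nat.Properties
open import Data.Nat.DivMod using (%-distribˡ-+; [m+kn]%n≡m%n; m/n*n≡m; m*n/n≡m; m<n⇒m%n≡m)
open import Data.Nat.Divisibility using (_∣_; divides; ∣-refl; ∣m∣n⇒∣m+n; ∣m⇒∣m*n; ∣n⇒∣m*n; *-monoʳ-∣; ∣⇒≤; m∣m*n; ∣1⇒≡1)
open import Data.Nat.Primality using (Prime; euclidsLemma; prime⇒nonTrivial)
open import Data.Nat.Combinatorics using (_C_; nCk≡n!/k![n-k]!; k![n∸k]!∣n!; nCn≡1; k>n⇒nCk≡0)
open import Data.Nat.GCD using (gcd)
open import Data.Nat.Solver using (module +-*-Solver)
open import Data.List using (List; []; _∷_; _++_; map; [_]; concatMap; upTo; applyUpTo; filter; length)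
open import Data.List.Properties using (++-assoc; ++-identityʳ)
open import Data.Vec as V using (Vec; []; _∷_)
open import Data.Vec.Properties using (∷-injective)
open import Data.Vec.Relation.Unary.All using (All; []; _∷_)
open import Data.Fin using (Fin; zero; suc; toℕ; fromℕ; inject₁)
open import Data.Fin.Properties using (toℕ-fromℕ; toℕ-inject₁; toℕ<n)
open import Data.Bool as Bool using (true; false; if_then_else_; _∧_)
open import Data.Bool.Properties using (T?)
open import Data.Product using (_×_; _,_; proj₁; proj₂; ∃)
open import Data.Sum using (inj₁; inj₂)
open import Data.Empty using (⊥; ⊥-elim)
open import Relation.Nullary using (¬_; yes; no; does)
open import Relation.Nullary.Decidable using (dec-true; dec-false)
open import Relation.Unary using (Decidable)
open import Relation.Binary using (tri<; tri≈; tri>)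
open import Relation.Binary.PropositionalEquality using (_≡_; _≢_; refl; sym; trans; cong; cong₂; subst; subst₂; module ≡-Reasoning)
open import Algebra.Bundles using (CommutativeSemiring)
open import Algebra.Structures using (IsCommutativeSemiring)
open import Algebra.Properties.Monoid.Sum +-0-monoid using (sum; sum-init-last; sum-cong-≗)
open import Algebra.Properties.CommutativeSemigroup +-commutativeSemigroup using (interchange; x∙yz≈y∙xz)
open +-*-Solver

-- A list of exponents L stands for the polynomial Σ_{x ∈ L} X^x with natural
-- coefficients.  It is observed through its pairing with test functions h,
-- Σ_{x ∈ L} h x; the coefficient of X^k is the pairing with the indicator of k.
eval : List ℕ → (ℕ → ℕ) → ℕ
eval []      h = 0
eval (x ∷ L) h = h x + eval L h

infixl 7 _⊛_
_⊛_ : List ℕ → List ℕ → List ℕ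
[]      ⊛ L = []
(x ∷ K) ⊛ L = map (x +_) L ++ K ⊛ L

infix 4 _≈_
_≈_ : List ℕ → List ℕ → Set
K ≈ L = ∀ h → eval K h ≡ eval L h

eval-++ : ∀ K L h → eval (K ++ L) h ≡ eval K h + eval L h
eval-++ []      L h = refl
eval-++ (x ∷ K) L h = trans (cong (h x +_) (eval-++ K L h)) (sym (+-assoc (h x) _ _))

eval-map : ∀ (f : ℕ → ℕ) L h → eval (map f L) h ≡ eval L (λ y → h (f y))
eval-map f []      h = refl
eval-map f (x ∷ L) h = cong (h (f x) +_) (eval-map f L h)

eval-cong : ∀ L {g h} → (∀ x → g x ≡ h x) → eval L g ≡ eval L h
eval-cong []      g≗h = refl
eval-cong (x ∷ L) g≗h = cong₂ _+_ (g≗h x) (eval-cong L g≗h)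

eval-zero : ∀ L → eval L (λ _ → 0) ≡ 0
eval-zero []      = refl
eval-zero (x ∷ L) = eval-zero L

eval-+ : ∀ L g h → eval L (λ x → g x + h x) ≡ eval L g + eval L h
eval-+ []      g h = refl
eval-+ (x ∷ L) g h =
  trans (cong (g x + h x +_) (eval-+ L g h)) (interchange (g x) (h x) (eval L g) (eval L h))

eval-⊛ : ∀ K L h → eval (K ⊛ L) h ≡ eval K (λ x → eval L (λ y → h (x + y)))
eval-⊛ []      L h = refl
eval-⊛ (x ∷ K) L h = trans (eval-++ (map (x +_) L) (K ⊛ L) h)
  (cong₂ _+_ (eval-map (x +_) L h) (eval-⊛ K L h))

eval-swap : ∀ K L (g : ℕ → ℕ → ℕ) →
  eval K (λ x → eval L (g x)) ≡ eval L (λ y → eval K (λ x → g x y))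
eval-swap []      L g = sym (eval-zero L)
eval-swap (x ∷ K) L g = trans (cong (eval L (g x) +_) (eval-swap K L g))
  (sym (eval-+ L (g x) (λ y → eval K (λ x → g x y))))

++-cong : ∀ {K K' L L'} → K ≈ K' → L ≈ L' → K ++ L ≈ K' ++ L'
++-cong {K} {K'} {L} {L'} K≈K' L≈L' h =
  trans (eval-++ K L h) (trans (cong₂ _+_ (K≈K' h) (L≈L' h)) (sym (eval-++ K' L' h)))

⊛-cong : ∀ {K K' L L'} → K ≈ K' → L ≈ L' → K ⊛ L ≈ K' ⊛ L'
⊛-cong {K} {K'} {L} {L'} K≈K' L≈L' h = begin
  eval (K ⊛ L) h                               ≡⟨ eval-⊛ K L h ⟩
  eval K (λ x → eval L (λ y → h (x + y)))      ≡⟨ eval-cong K (λ x → L≈L' (λ y → h (x + y))) ⟩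
  eval K (λ x → eval L' (λ y → h (x + y)))     ≡⟨ K≈K' _ ⟩
  eval K' (λ x → eval L' (λ y → h (x + y)))    ≡⟨ sym (eval-⊛ K' L' h) ⟩
  eval (K' ⊛ L') h                             ∎
  where open ≡-Reasoning

⊛-assoc : ∀ K L M → (K ⊛ L) ⊛ M ≈ K ⊛ (L ⊛ M)
⊛-assoc K L M h = begin
  eval ((K ⊛ L) ⊛ M) h                                                 ≡⟨ eval-⊛ (K ⊛ L) M h ⟩
  eval (K ⊛ L) (λ x → eval M (λ z → h (x + z)))                        ≡⟨ eval-⊛ K L _ ⟩
  eval K (λ x → eval L (λ y → eval M (λ z → h (x + y + z))))           ≡⟨ eval-cong K (λ x → eval-cong L (λ y → eval-cong M (λ z → cong h (+-assoc x y z)))) ⟩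
  eval K (λ x → eval L (λ y → eval M (λ z → h (x + (y + z)))))         ≡⟨ eval-cong K (λ x → sym (eval-⊛ L M (λ w → h (x + w)))) ⟩
  eval K (λ x → eval (L ⊛ M) (λ w → h (x + w)))                        ≡⟨ sym (eval-⊛ K (L ⊛ M) h) ⟩
  eval (K ⊛ (L ⊛ M)) h                                                 ∎
  where open ≡-Reasoning

⊛-comm : ∀ K L → K ⊛ L ≈ L ⊛ K
⊛-comm K L h = begin
  eval (K ⊛ L) h                              ≡⟨ eval-⊛ K L h ⟩
  eval K (λ x → eval L (λ y → h (x + y)))     ≡⟨ eval-swap K L _ ⟩
  eval L (λ y → eval K (λ x → h (x + y)))     ≡⟨ eval-cong L (λ y → eval-cong K (λ x → cong h (+-comm x y))) ⟩
  eval L (λ y → eval K (λ x → h (y + x)))     ≡⟨ sym (eval-⊛ L K h) ⟩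
  eval (L ⊛ K) h                              ∎
  where open ≡-Reasoning

⊛-identityˡ : ∀ L → [ 0 ] ⊛ L ≈ L
⊛-identityˡ L h = trans (eval-⊛ [ 0 ] L h) (+-identityʳ _)

⊛-distribʳ : ∀ M K L → (K ++ L) ⊛ M ≈ K ⊛ M ++ L ⊛ M
⊛-distribʳ M K L h = begin
  eval ((K ++ L) ⊛ M) h                     ≡⟨ eval-⊛ (K ++ L) M h ⟩
  eval (K ++ L) g                           ≡⟨ eval-++ K L g ⟩
  eval K g + eval L g                       ≡⟨ sym (cong₂ _+_ (eval-⊛ K M h) (eval-⊛ L M h)) ⟩
  eval (K ⊛ M) h + eval (L ⊛ M) h           ≡⟨ sym (eval-++ (K ⊛ M) (L ⊛ M) h) ⟩
  eval (K ⊛ M ++ L ⊛ M) h                   ∎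
  where
  open ≡-Reasoning
  g : ℕ → ℕ
  g x = eval M (λ y → h (x + y))

-- Exponent lists modulo ≈ form a commutative semiring: they are exactly ℕ[X].
-- The axioms involving products on the right follow from commutativity.
polynomialSemiring : CommutativeSemiring _ _
polynomialSemiring = record
  { Carrier = List ℕ ; _≈_ = _≈_ ; _+_ = _++_ ; _*_ = _⊛_ ; 0# = [] ; 1# = [ 0 ]
  ; isCommutativeSemiring = isCommutativeSemiring }
  where
  ≈-trans : ∀ {K L M} → K ≈ L → L ≈ M → K ≈ M
  ≈-trans K≈L L≈M h = trans (K≈L h) (L≈M h)

  isCommutativeSemiring : IsCommutativeSemiring _≈_ _++_ _⊛_ [] [ 0 ]
  isCommutativeSemiring = record
    { isSemiring = record
      { isSemiringWithoutAnnihilatingZero = record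
        { +-isCommutativeMonoid = record
          { isMonoid = record
            { isSemigroup = record
              { isMagma = record
                { isEquivalence = record
                  { refl = λ h → refl ; sym = λ e h → sym (e h) ; trans = λ {K} {L} {M} → ≈-trans {K} {L} {M} }
                ; ∙-cong = λ {K} {K'} {L} {L'} → ++-cong {K} {K'} {L} {L'} }
              ; assoc = λ K L M h → cong (λ w → eval w h) (++-assoc K L M) }
            ; identity = (λ L h → refl) , (λ L h → cong (λ w → eval w h) (++-identityʳ L)) }
          ; comm = λ K L h → trans (eval-++ K L h) (trans (+-comm (eval K h) _) (sym (eval-++ L K h))) }
        ; *-cong = λ {K} {K'} {L} {L'} → ⊛-cong {K} {K'} {L} {L'}
        ; *-assoc = ⊛-assoc
        ; *-identity = ⊛-identityˡ , (λ L → ≈-trans {L ⊛ [ 0 ]} {[ 0 ] ⊛ L} {L} (⊛-comm L [ 0 ]) (⊛-identityˡ L))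
        ; distrib = (λ M K L → ≈-trans {M ⊛ (K ++ L)} {(K ++ L) ⊛ M} {M ⊛ K ++ M ⊛ L} (⊛-comm M (K ++ L))
                      (≈-trans {(K ++ L) ⊛ M} {K ⊛ M ++ L ⊛ M} {M ⊛ K ++ M ⊛ L} (⊛-distribʳ M K L)
                        (++-cong {K ⊛ M} {M ⊛ K} {L ⊛ M} {M ⊛ L} (⊛-comm K M) (⊛-comm L M))))
                  , ⊛-distribʳ
        }
      ; zero = (λ L h → refl) , (λ L → ≈-trans {L ⊛ []} {[] ⊛ L} {[]} (⊛-comm L []) (λ h → refl))
      }
    ; *-comm = ⊛-comm
    }

open CommutativeSemiring polynomialSemiring using (semiring)
open import Algebra.Properties.Semiring.Exp semiring using (^-assocʳ; ^-congʳ; ^-congˡ; ^-homo-*) renaming (_^_ to _^ₗ_)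
open import Algebra.Properties.Semiring.Mult semiring using () renaming (_×_ to _×ₗ_)
open import Algebra.Properties.Monoid.Sum (CommutativeSemiring.+-monoid polynomialSemiring) using () renaming (sum to sumₗ)
import Algebra.Properties.CommutativeSemiring.Binomial polynomialSemiring as Binomial

infix 4 _∼[_]_
_∼[_]_ : List ℕ → (p : ℕ) → .{{NonZero p}} → List ℕ → Set
K ∼[ p ] L = ∀ h → eval K h % p ≡ eval L h % p

+-congˡ-% : ∀ p .{{_ : NonZero p}} z {x y} → x % p ≡ y % p → (z + x) % p ≡ (z + y) % p
+-congˡ-% p z {x} {y} x≡y = begin
  (z + x) % p             ≡⟨ %-distribˡ-+ z x p ⟩
  (z % p + x % p) % p     ≡⟨ cong (λ w → (z % p + w) % p) x≡y ⟩
  (z % p + y % p) % p     ≡⟨ sym (%-distribˡ-+ z y p) ⟩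
  (z + y) % p             ∎
  where open ≡-Reasoning

+-congʳ-% : ∀ p .{{_ : NonZero p}} z {x y} → x % p ≡ y % p → (x + z) % p ≡ (y + z) % p
+-congʳ-% p z {x} {y} x≡y =
  trans (cong (_% p) (+-comm x z)) (trans (+-congˡ-% p z x≡y) (cong (_% p) (+-comm z y)))

eval-cong-% : ∀ p .{{_ : NonZero p}} L {g g'} → (∀ x → g x % p ≡ g' x % p) →
  eval L g % p ≡ eval L g' % p
eval-cong-% p []      g≡g' = refl
eval-cong-% p (x ∷ L) {g} {g'} g≡g' =
  trans (+-congʳ-% p (eval L g) (g≡g' x)) (+-congˡ-% p (g' x) (eval-cong-% p L g≡g'))

⊛-cong-% : ∀ p .{{_ : NonZero p}} {K K' L L'} → K ∼[ p ] K' → L ∼[ p ] L' → K ⊛ L ∼[ p ] K' ⊛ L'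
⊛-cong-% p {K} {K'} {L} {L'} K≡K' L≡L' h = begin
  eval (K ⊛ L) h % p                                 ≡⟨ cong (_% p) (eval-⊛ K L h) ⟩
  eval K (λ x → eval L (λ y → h (x + y))) % p        ≡⟨ eval-cong-% p K (λ x → L≡L' (λ y → h (x + y))) ⟩
  eval K (λ x → eval L' (λ y → h (x + y))) % p       ≡⟨ K≡K' _ ⟩
  eval K' (λ x → eval L' (λ y → h (x + y))) % p      ≡⟨ cong (_% p) (sym (eval-⊛ K' L' h)) ⟩
  eval (K' ⊛ L') h % p                               ∎
  where open ≡-Reasoning

^-cong-% : ∀ p .{{_ : NonZero p}} {K K'} n → K ∼[ p ] K' → K ^ₗ n ∼[ p ] K' ^ₗ n
^-cong-% p         zero    K≡K' h = refl
^-cong-% p {K} {K'} (suc n) K≡K' =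
  ⊛-cong-% p {K} {K'} {K ^ₗ n} {K' ^ₗ n} K≡K' (^-cong-% p {K} {K'} n K≡K')

monomial-^ : ∀ x k → [ x ] ^ₗ k ≈ [ k * x ]
monomial-^ x zero    h = refl
monomial-^ x (suc k) h = begin
  eval ([ x ] ⊛ [ x ] ^ₗ k) h                ≡⟨ eval-⊛ [ x ] ([ x ] ^ₗ k) h ⟩
  eval ([ x ] ^ₗ k) (λ y → h (x + y)) + 0    ≡⟨ cong (_+ 0) (monomial-^ x k (λ y → h (x + y))) ⟩
  h (x + k * x) + 0 + 0                      ≡⟨ +-identityʳ _ ⟩
  h (x + k * x) + 0                          ∎
  where open ≡-Reasoning

monomial-^-⊛ : ∀ x k K h → eval ([ x ] ^ₗ k ⊛ K) h ≡ eval K (λ y → h (k * x + y))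
monomial-^-⊛ x k K h = trans (eval-⊛ ([ x ] ^ₗ k) K h) (trans (monomial-^ x k _) (+-identityʳ _))

eval-× : ∀ n L h → eval (n ×ₗ L) h ≡ n * eval L h
eval-× zero    L h = refl
eval-× (suc n) L h = trans (eval-++ L (n ×ₗ L) h) (cong (eval L h +_) (eval-× n L h))

eval-sum : ∀ n (f : Fin n → List ℕ) h → eval (sumₗ f) h ≡ sum (λ i → eval (f i) h)
eval-sum zero    f h = refl
eval-sum (suc n) f h = trans (eval-++ (f zero) _ h) (cong (eval (f zero) h +_) (eval-sum n (λ i → f (suc i)) h))

sum-≡-last-% : ∀ p .{{_ : NonZero p}} m (g : Fin (suc m) → ℕ) →
  (∀ i → p ∣ g (inject₁ i)) → sum g % p ≡ g (fromℕ m) % p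
sum-≡-last-% p m g p∣g = begin
  sum g % p                                        ≡⟨ cong (_% p) (sum-init-last g) ⟩
  (sum (λ i → g (inject₁ i)) + g (fromℕ m)) % p    ≡⟨ cong (λ z → (z + g (fromℕ m)) % p) (_∣_.equality p∣init) ⟩
  (k * p + g (fromℕ m)) % p                        ≡⟨ cong (_% p) (+-comm (k * p) (g (fromℕ m))) ⟩
  (g (fromℕ m) + k * p) % p                        ≡⟨ [m+kn]%n≡m%n (g (fromℕ m)) k p ⟩
  g (fromℕ m) % p                                  ∎
  where
  open ≡-Reasoning
  ∣-sum : ∀ n (f : Fin n → ℕ) → (∀ i → p ∣ f i) → p ∣ sum f
  ∣-sum zero    f p∣f = divides 0 refl
  ∣-sum (suc n) f p∣f = ∣m∣n⇒∣m+n (p∣f zero) (∣-sum n (λ i → f (suc i)) (λ i → p∣f (suc i)))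

  p∣init : p ∣ sum (λ i → g (inject₁ i))
  p∣init = ∣-sum m _ p∣g

  k : ℕ
  k = _∣_.quotient p∣init

p∤m! : ∀ {p} → Prime p → ∀ m → m < p → ¬ p ∣ m !
p∤m! {p} pp zero    m<p p∣1 = <⇒≢ (nonTrivial⇒n>1 p {{prime⇒nonTrivial pp}}) (sym (∣1⇒≡1 p∣1))
p∤m! {p} pp (suc m) m<p p∣m! with euclidsLemma (suc m) (m !) pp p∣m!
... | inj₁ p∣1+m = <⇒≱ m<p (∣⇒≤ p∣1+m)
... | inj₂ p∣m!  = p∤m! pp m (<-trans (n<1+n m) m<p) p∣m!

binomial*factorials : ∀ n k → k ≤ n → (n C k) * (k ! * (n ∸ k) !) ≡ n !
binomial*factorials n k k≤n =
  trans (cong (_* (k ! * (n ∸ k) !)) (nCk≡n!/k![n-k]! k≤n))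
        (m/n*n≡m {{k !* (n ∸ k) !≢0}} (k![n∸k]!∣n! k≤n))

p∣pCk : ∀ {p} → Prime p → ∀ k → 0 < k → k < p → p ∣ p C k
p∣pCk {p@(suc p-1)} pp k 0<k k<p
  with euclidsLemma (p C k) (k ! * (p ∸ k) !) pp
         (subst (p ∣_) (sym (binomial*factorials p k (<⇒≤ k<p))) (m∣m*n (p-1 !)))
... | inj₁ p∣pCk = p∣pCk
... | inj₂ p∣k![p-k]! with euclidsLemma (k !) ((p ∸ k) !) pp p∣k![p-k]!
...   | inj₁ p∣k!     = ⊥-elim (p∤m! pp k k<p p∣k!)
...   | inj₂ p∣[p-k]! = ⊥-elim (p∤m! pp (p ∸ k) (∸-monoʳ-< 0<k (<⇒≤ k<p)) p∣[p-k]!)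

frobenius : ∀ {p} → Prime p → .{{_ : NonZero p}} → ∀ L → L ^ₗ p ∼[ p ] map (p *_) L
frobenius {suc p-1}   pp []      h = refl
frobenius {p@(suc p-1)} pp (x ∷ L) h = begin
  eval ((x ∷ L) ^ₗ p) h % p                          ≡⟨ cong (_% p) (Binomial.theorem p [ x ] L h) ⟩
  eval (Binomial.binomialExpansion [ x ] L p) h % p  ≡⟨ cong (_% p) (eval-sum (suc p) (Binomial.binomialTerm [ x ] L p) h) ⟩
  (term zero + sum (λ i → term (suc i))) % p         ≡⟨ +-congˡ-% p (term zero) (sum-≡-last-% p p-1 (λ i → term (suc i)) middle-terms) ⟩
  (term zero + term (fromℕ p)) % p                   ≡⟨ cong (_% p) (cong₂ _+_ first-term last-term) ⟩
  (eval (L ^ₗ p) h + h (p * x)) % p                  ≡⟨ +-congʳ-% p (h (p * x)) {eval (L ^ₗ p) h} {eval (map (p *_) L) h} (frobenius pp L h) ⟩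
  (eval (map (p *_) L) h + h (p * x)) % p            ≡⟨ cong (_% p) (+-comm _ (h (p * x))) ⟩
  eval (map (p *_) (x ∷ L)) h % p                    ∎
  where
  open ≡-Reasoning
  term : Fin (suc p) → ℕ
  term k = eval (Binomial.binomialTerm [ x ] L p k) h

  term≡ : ∀ k → term k ≡ (p C toℕ k) * eval ([ x ] ^ₗ toℕ k ⊛ L ^ₗ (p ∸ toℕ k)) h
  term≡ k = eval-× (p C toℕ k) _ h

  middle-terms : ∀ i → p ∣ term (suc (inject₁ i))
  middle-terms i = subst (p ∣_) (sym (term≡ (suc (inject₁ i)))) (∣m⇒∣m*n _
    (p∣pCk pp (suc (toℕ (inject₁ i))) (s≤s z≤n)
      (s≤s (subst (_< p-1) (sym (toℕ-inject₁ i)) (toℕ<n i)))))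

  first-term : term zero ≡ eval (L ^ₗ p) h
  first-term = trans (term≡ zero) (trans (*-identityˡ _) (monomial-^-⊛ x 0 (L ^ₗ p) h))

  last-term : term (fromℕ p) ≡ h (p * x)
  last-term = begin
    term (fromℕ p)                                          ≡⟨ term≡ (fromℕ p) ⟩
    (p C toℕ (fromℕ p)) * eval ([ x ] ^ₗ toℕ (fromℕ p) ⊛ L ^ₗ (p ∸ toℕ (fromℕ p))) h
      ≡⟨ cong (λ k → (p C k) * eval ([ x ] ^ₗ k ⊛ L ^ₗ (p ∸ k)) h) (toℕ-fromℕ p) ⟩
    (p C p) * eval ([ x ] ^ₗ p ⊛ L ^ₗ (p ∸ p)) h             ≡⟨ cong₂ (λ c k → c * eval ([ x ] ^ₗ p ⊛ L ^ₗ k) h) (nCn≡1 p) (n∸n≡0 p) ⟩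
    1 * eval ([ x ] ^ₗ p ⊛ [ 0 ]) h                         ≡⟨ *-identityˡ _ ⟩
    eval ([ x ] ^ₗ p ⊛ [ 0 ]) h                             ≡⟨ monomial-^-⊛ x p [ 0 ] h ⟩
    h (p * x + 0) + 0                                       ≡⟨ trans (+-identityʳ _) (cong h (+-identityʳ _)) ⟩
    h (p * x)                                               ∎

frobenius-^ : ∀ {p} → Prime p → .{{_ : NonZero p}} → ∀ m L → L ^ₗ (p ^ m) ∼[ p ] map ((p ^ m) *_) L
frobenius-^ {p} pp zero    L h = cong (_% p) (begin
  eval (L ⊛ [ 0 ]) h          ≡⟨ eval-⊛ L [ 0 ] h ⟩
  eval L (λ x → h (x + 0) + 0) ≡⟨ eval-cong L (λ x → trans (+-identityʳ _) (cong h (+-identityʳ x))) ⟩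
  eval L h                    ≡⟨ sym (trans (eval-map (1 *_) L h) (eval-cong L (λ x → cong h (*-identityˡ x)))) ⟩
  eval (map (1 *_) L) h       ∎)
  where open ≡-Reasoning
frobenius-^ {p} pp (suc m) L h = begin
  eval (L ^ₗ (p * p ^ m)) h % p               ≡⟨ cong (_% p) (^-congʳ L (*-comm p (p ^ m)) h) ⟩
  eval (L ^ₗ (p ^ m * p)) h % p               ≡⟨ cong (_% p) (sym (^-assocʳ L (p ^ m) p h)) ⟩
  eval ((L ^ₗ (p ^ m)) ^ₗ p) h % p            ≡⟨ ^-cong-% p {L ^ₗ (p ^ m)} {L'} p (frobenius-^ pp m L) h ⟩
  eval (L' ^ₗ p) h % p                        ≡⟨ frobenius pp L' h ⟩
  eval (map (p *_) L') h % p                  ≡⟨ cong (_% p) scale-scale ⟩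
  eval (map ((p * p ^ m) *_) L) h % p         ∎
  where
  open ≡-Reasoning
  L' : List ℕ
  L' = map ((p ^ m) *_) L
  scale-scale : eval (map (p *_) L') h ≡ eval (map ((p * p ^ m) *_) L) h
  scale-scale = begin
    eval (map (p *_) L') h                    ≡⟨ eval-map (p *_) L' h ⟩
    eval L' (λ y → h (p * y))                 ≡⟨ eval-map ((p ^ m) *_) L _ ⟩
    eval L (λ y → h (p * (p ^ m * y)))        ≡⟨ eval-cong L (λ y → cong h (sym (*-assoc p (p ^ m) y))) ⟩
    eval L (λ y → h (p * p ^ m * y))          ≡⟨ sym (eval-map _ L h) ⟩
    eval (map ((p * p ^ m) *_) L) h           ∎

≡ᵇ-true : ∀ {m n} → m ≡ n → (m ≡ᵇ n) ≡ true
≡ᵇ-true {m} {n} = dec-true (m ≟ n)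

≡ᵇ-false : ∀ {m n} → m ≢ n → (m ≡ᵇ n) ≡ false
≡ᵇ-false {m} {n} = dec-false (m ≟ n)

sumOver : {A : Set} → (A → ℕ) → List A → ℕ
sumOver F L = sumL (map F L)

∑< : ℕ → (ℕ → ℕ) → ℕ
∑< n g = sum {n} (λ i → g (toℕ i))

sumOver-++ : {A : Set} (F : A → ℕ) → ∀ K L → sumOver F (K ++ L) ≡ sumOver F K + sumOver F L
sumOver-++ F []      L = refl
sumOver-++ F (x ∷ K) L = trans (cong (F x +_) (sumOver-++ F K L)) (sym (+-assoc (F x) _ _))

sumOver-concatMap : {A B : Set} (F : B → ℕ) (G : A → List B) → ∀ L →
  sumOver F (concatMap G L) ≡ sumOver (λ x → sumOver F (G x)) L
sumOver-concatMap F G []      = refl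
sumOver-concatMap F G (x ∷ L) = trans (sumOver-++ F (G x) (concatMap G L))
  (cong (sumOver F (G x) +_) (sumOver-concatMap F G L))

sumOver-map : {A B : Set} (F : B → ℕ) (g : A → B) → ∀ L → sumOver F (map g L) ≡ sumOver (λ x → F (g x)) L
sumOver-map F g []      = refl
sumOver-map F g (x ∷ L) = cong (F (g x) +_) (sumOver-map F g L)

sumOver-cong : {A : Set} {F G : A → ℕ} → ∀ L → (∀ x → F x ≡ G x) → sumOver F L ≡ sumOver G L
sumOver-cong []      F≗G = refl
sumOver-cong (x ∷ L) F≗G = cong₂ _+_ (F≗G x) (sumOver-cong L F≗G)

sumOver-* : {A : Set} (c : ℕ) (F : A → ℕ) → ∀ L → sumOver (λ x → c * F x) L ≡ c * sumOver F L
sumOver-* c F []      = sym (*-zeroʳ c)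
sumOver-* c F (x ∷ L) = trans (cong (c * F x +_) (sumOver-* c F L)) (sym (*-distribˡ-+ c (F x) _))

sumOver-zero : {A : Set} (F : A → ℕ) → ∀ L → (∀ x → F x ≡ 0) → sumOver F L ≡ 0
sumOver-zero F []      F≗0 = refl
sumOver-zero F (x ∷ L) F≗0 = cong₂ _+_ (F≗0 x) (sumOver-zero F L F≗0)

∑<-cong : ∀ n {g g'} → (∀ i → g i ≡ g' i) → ∑< n g ≡ ∑< n g'
∑<-cong zero    g≗g' = refl
∑<-cong (suc n) g≗g' = cong₂ _+_ (g≗g' 0) (∑<-cong n (λ i → g≗g' (suc i)))

∑<-suc : ∀ n g → ∑< (suc n) g ≡ ∑< n g + g n
∑<-suc zero    g = +-comm (g 0) 0
∑<-suc (suc n) g = trans (cong (g 0 +_) (∑<-suc n (λ i → g (suc i)))) (sym (+-assoc (g 0) _ _))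

∑<-upTo : ∀ n g → sumOver g (upTo n) ≡ ∑< n g
∑<-upTo n g = go n (λ i → i)
  where
  go : ∀ n f → sumOver g (applyUpTo f n) ≡ ∑< n (λ i → g (f i))
  go zero    f = refl
  go (suc n) f = cong (g (f 0) +_) (go n (λ i → f (suc i)))

∑<-zero : ∀ n g → (∀ i → i < n → g i ≡ 0) → ∑< n g ≡ 0
∑<-zero zero    g g≗0 = refl
∑<-zero (suc n) g g≗0 = cong₂ _+_ (g≗0 0 (s≤s z≤n)) (∑<-zero n (λ i → g (suc i)) (λ i i<n → g≗0 (suc i) (s≤s i<n)))

∑<-extend : ∀ s n g → s ≤ n → (∀ i → s ≤ i → g i ≡ 0) → ∑< n g ≡ ∑< s g
∑<-extend zero    n       g _         g≗0 = ∑<-zero n g (λ i _ → g≗0 i z≤n)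
∑<-extend (suc s) (suc n) g (s≤s s≤n) g≗0 =
  cong (g 0 +_) (∑<-extend s n (λ i → g (suc i)) s≤n (λ i s≤i → g≗0 (suc i) (s≤s s≤i)))

∑<-single : ∀ n y g → y < n → (∀ x → x ≢ y → g x ≡ 0) → ∑< n g ≡ g y
∑<-single (suc n) zero    g _         g≗0 =
  trans (cong (g 0 +_) (∑<-zero n _ (λ i _ → g≗0 (suc i) (λ ())))) (+-identityʳ _)
∑<-single (suc n) (suc y) g (s≤s y<n) g≗0 =
  trans (cong (_+ ∑< n (λ i → g (suc i))) (g≗0 0 (λ ())))
        (∑<-single n y (λ i → g (suc i)) y<n (λ x x≢y → g≗0 (suc x) (λ eq → x≢y (suc-injective eq))))

prodFact∣ : ∀ xs → prodFact xs ∣ (sumL xs) !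
prodFact∣ []       = ∣-refl
prodFact∣ (x ∷ xs) = subst (x ! * prodFact xs ∣_) (binomial*factorials (x + sumL xs) x (m≤m+n x _))
  (∣n⇒∣m*n ((x + sumL xs) C x)
    (*-monoʳ-∣ (x !) (subst (λ z → prodFact xs ∣ z !) (sym (m+n∸m≡n x (sumL xs))) (prodFact∣ xs))))

multinomial-cons : ∀ s x xs → multinomial s (x ∷ xs) ≡ (s C x) * multinomial (s ∸ x) xs
multinomial-cons s x xs with x ≤? s
... | no x≰s rewrite ≡ᵇ-false {x + sumL xs} {s} (λ eq → x≰s (subst (x ≤_) eq (m≤m+n x _)))
                   | k>n⇒nCk≡0 (≰⇒> x≰s) = refl
... | yes x≤s with sumL xs ≟ s ∸ x
...   | no rest≢ rewrite ≡ᵇ-false {x + sumL xs} {s} (λ eq → rest≢ (trans (sym (m+n∸m≡n x _)) (cong (_∸ x) eq)))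
                   | ≡ᵇ-false rest≢ = sym (*-zeroʳ (s C x))
...   | yes rest≡ rewrite ≡ᵇ-true {x + sumL xs} {s} (trans (cong (x +_) rest≡) (m+[n∸m]≡n x≤s))
                   | ≡ᵇ-true rest≡ = quotient-split
  where
  open ≡-Reasoning
  P : ℕ
  P = prodFact xs
  F : ℕ
  F = (s ∸ x) !
  instance
    _ : NonZero P
    _ = prodFact≢0 xs
    _ : NonZero (x ! * P)
    _ = prodFact≢0 (x ∷ xs)
  s!≡ : s ! ≡ ((s C x) * (F / P)) * (x ! * P)
  s!≡ = begin
    s !                               ≡⟨ sym (binomial*factorials s x x≤s) ⟩
    (s C x) * (x ! * F)               ≡⟨ cong (λ z → (s C x) * (x ! * z)) (sym (m/n*n≡m (subst (λ z → P ∣ z !) rest≡ (prodFact∣ xs)))) ⟩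
    (s C x) * (x ! * (F / P * P))     ≡⟨ solve 4 (λ c a f p → c :* (a :* (f :* p)) := (c :* f) :* (a :* p)) refl (s C x) (x !) (F / P) P ⟩
    ((s C x) * (F / P)) * (x ! * P)   ∎
  quotient-split : s ! / (x ! * P) ≡ (s C x) * (F / P)
  quotient-split = trans (cong (_/ (x ! * P)) s!≡) (m*n/n≡m _ (x ! * P))

dot : ∀ {a} → Vec ℕ a → Vec ℕ a → ℕ
dot []       []       = 0
dot (x ∷ xs) (c ∷ cs) = x * c + dot xs cs

binomial-eval : ∀ c L s h →
  eval ((c ∷ L) ^ₗ s) h ≡ ∑< (suc s) (λ j → (s C j) * eval (L ^ₗ (s ∸ j)) (λ y → h (j * c + y)))
binomial-eval c L s h = begin
  eval ((c ∷ L) ^ₗ s) h                                      ≡⟨ Binomial.theorem s [ c ] L h ⟩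
  eval (Binomial.binomialExpansion [ c ] L s) h              ≡⟨ eval-sum (suc s) (Binomial.binomialTerm [ c ] L s) h ⟩
  sum (λ j → eval (Binomial.binomialTerm [ c ] L s j) h)     ≡⟨ sum-cong-≗ term≡ ⟩
  ∑< (suc s) (λ j → (s C j) * eval (L ^ₗ (s ∸ j)) (λ y → h (j * c + y))) ∎
  where
  open ≡-Reasoning
  term≡ : ∀ j → eval (Binomial.binomialTerm [ c ] L s j) h
              ≡ (s C toℕ j) * eval (L ^ₗ (s ∸ toℕ j)) (λ y → h (toℕ j * c + y))
  term≡ j = trans (eval-× (s C toℕ j) _ h)
    (cong ((s C toℕ j) *_) (monomial-^-⊛ c (toℕ j) (L ^ₗ (s ∸ toℕ j)) h))

multinomial-theorem : ∀ a (c : Vec ℕ a) B s → s ≤ B → ∀ h →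
  eval (V.toList c ^ₗ s) h ≡ sumOver (λ α → multinomial s (V.toList α) * h (dot α c)) (boxVecs a B)
multinomial-theorem zero    []       B zero    _   h = cong (_+ 0) (sym (*-identityˡ (h 0)))
multinomial-theorem zero    []       B (suc s) _   h = refl
multinomial-theorem (suc a) (c ∷ cs) B s       s≤B h = begin
  eval ((c ∷ V.toList cs) ^ₗ s) h                                ≡⟨ binomial-eval c (V.toList cs) s h ⟩
  ∑< (suc s) (λ x → (s C x) * G x)                                ≡⟨ sym (∑<-extend (suc s) (suc B) _ (s≤s s≤B) (λ x s<x → cong (_* G x) (k>n⇒nCk≡0 s<x))) ⟩
  ∑< (suc B) (λ x → (s C x) * G x)                                ≡⟨ ∑<-cong (suc B) first-coordinate ⟩
  ∑< (suc B) (λ x → sumOver F (map (x ∷_) (boxVecs a B)))        ≡⟨ sym (∑<-upTo (suc B) _) ⟩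
  sumOver (λ x → sumOver F (map (x ∷_) (boxVecs a B))) (upTo (suc B)) ≡⟨ sym (sumOver-concatMap F (λ x → map (x ∷_) (boxVecs a B)) (upTo (suc B))) ⟩
  sumOver F (boxVecs (suc a) B)                                  ∎
  where
  open ≡-Reasoning
  G : ℕ → ℕ
  G x = eval (V.toList cs ^ₗ (s ∸ x)) (λ y → h (x * c + y))
  F : Vec ℕ (suc a) → ℕ
  F α = multinomial s (V.toList α) * h (dot α (c ∷ cs))
  first-coordinate : ∀ x → (s C x) * G x ≡ sumOver F (map (x ∷_) (boxVecs a B))
  first-coordinate x = begin
    (s C x) * G x
      ≡⟨ cong ((s C x) *_) (multinomial-theorem a cs B (s ∸ x) (≤-trans (m∸n≤m s x) s≤B) (λ y → h (x * c + y))) ⟩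
    (s C x) * sumOver (λ α → multinomial (s ∸ x) (V.toList α) * h (x * c + dot α cs)) (boxVecs a B)
      ≡⟨ sym (sumOver-* (s C x) _ (boxVecs a B)) ⟩
    sumOver (λ α → (s C x) * (multinomial (s ∸ x) (V.toList α) * h (x * c + dot α cs))) (boxVecs a B)
      ≡⟨ sumOver-cong (boxVecs a B) (λ α → trans (sym (*-assoc (s C x) _ _))
           (cong (_* h (x * c + dot α cs)) (sym (multinomial-cons s x (V.toList α))))) ⟩
    sumOver (λ α → F (x ∷ α)) (boxVecs a B)
      ≡⟨ sym (sumOver-map F (x ∷_) (boxVecs a B)) ⟩
    sumOver F (map (x ∷_) (boxVecs a B)) ∎

sumOver-box-single : ∀ a B (F : Vec ℕ a → ℕ) (v : Vec ℕ a) → All (_≤ B) v →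
  (∀ β → β ≢ v → F β ≡ 0) → sumOver F (boxVecs a B) ≡ F v
sumOver-box-single zero    B F []      []           _   = +-identityʳ _
sumOver-box-single (suc a) B F (y ∷ v) (y≤B ∷ v≤B) F≗0 = begin
  sumOver F (boxVecs (suc a) B)                                     ≡⟨ sumOver-concatMap F (λ x → map (x ∷_) (boxVecs a B)) (upTo (suc B)) ⟩
  sumOver G (upTo (suc B))                                          ≡⟨ ∑<-upTo (suc B) G ⟩
  ∑< (suc B) G                                                      ≡⟨ ∑<-single (suc B) y G (s≤s y≤B) G≗0 ⟩
  G y                                                               ≡⟨ sumOver-map F (y ∷_) (boxVecs a B) ⟩
  sumOver (λ β → F (y ∷ β)) (boxVecs a B)                           ≡⟨ sumOver-box-single a B (λ β → F (y ∷ β)) v v≤B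
                                                                         (λ β β≢v → F≗0 (y ∷ β) (λ eq → β≢v (proj₂ (∷-injective eq)))) ⟩
  F (y ∷ v)                                                         ∎
  where
  open ≡-Reasoning
  G : ℕ → ℕ
  G x = sumOver F (map (x ∷_) (boxVecs a B))
  G≗0 : ∀ x → x ≢ y → G x ≡ 0
  G≗0 x x≢y = trans (sumOver-map F (x ∷_) (boxVecs a B))
    (sumOver-zero (λ β → F (x ∷ β)) (boxVecs a B) (λ β → F≗0 (x ∷ β) (λ eq → x≢y (proj₁ (∷-injective eq)))))

sumOver-filter : {A : Set} {P : A → Set} (P? : Decidable P) (F : A → ℕ) → ∀ L →
  sumOver F (filter P? L) ≡ sumOver (λ x → if does (P? x) then F x else 0) L
sumOver-filter P? F []      = refl
sumOver-filter P? F (x ∷ L) with does (P? x)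
... | true  = cong (F x +_) (sumOver-filter P? F L)
... | false = sumOver-filter P? F L

multinomial-wrong-sum : ∀ n xs → sumL xs ≢ n → multinomial n xs ≡ 0
multinomial-wrong-sum n xs sum≢n rewrite ≡ᵇ-false sum≢n = refl

multinomial-concentrated : ∀ r n → multinomial r (r ∷ V.toList (V.replicate n 0)) ≡ 1
multinomial-concentrated r n = begin
  multinomial r (r ∷ zeros)            ≡⟨ multinomial-cons r r zeros ⟩
  (r C r) * multinomial (r ∸ r) zeros  ≡⟨ cong₂ (λ c k → c * multinomial k zeros) (nCn≡1 r) (n∸n≡0 r) ⟩
  1 * multinomial 0 zeros              ≡⟨ *-identityˡ _ ⟩
  multinomial 0 zeros                  ≡⟨ multinomial-0 n ⟩
  1                                    ∎
  where
  open ≡-Reasoning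
  zeros : List ℕ
  zeros = V.toList (V.replicate n 0)
  multinomial-0 : ∀ n → multinomial 0 (V.toList (V.replicate n 0)) ≡ 1
  multinomial-0 zero    = refl
  multinomial-0 (suc n) = trans (multinomial-cons 0 0 (V.toList (V.replicate n 0))) (trans (*-identityˡ _) (multinomial-0 n))

indicator : ℕ → ℕ → ℕ
indicator k x = if x ≡ᵇ k then 1 else 0

shifted : ℕ → Poly → ℕ → ℕ
shifted zero    P k       = coeff P k
shifted (suc m) P zero    = 0
shifted (suc m) P (suc k) = shifted m P k

shifted-+ : ∀ m P j → shifted m P (m + j) ≡ coeff P j
shifted-+ zero    P j = refl
shifted-+ (suc m) P j = shifted-+ m P j

shifted-< : ∀ m P k → k < m → shifted m P k ≡ 0
shifted-< (suc m) P zero    _         = refl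
shifted-< (suc m) P (suc k) (s≤s k<m) = shifted-< m P k k<m

shifted-[] : ∀ m k → shifted m [] k ≡ 0
shifted-[] zero    k       = refl
shifted-[] (suc m) zero    = refl
shifted-[] (suc m) (suc k) = shifted-[] m k

coeff-beyond : ∀ R k → length R ≤ k → coeff R k ≡ 0
coeff-beyond []      k       _         = refl
coeff-beyond (x ∷ R) (suc k) (s≤s l≤k) = coeff-beyond R k l≤k

coeff-⊕ : ∀ A B k → coeff (A ⊕ B) k ≡ coeff A k + coeff B k
coeff-⊕ []      B       k       = refl
coeff-⊕ (a ∷ A) []      zero    = sym (+-identityʳ a)
coeff-⊕ (a ∷ A) []      (suc k) = sym (+-identityʳ _)
coeff-⊕ (a ∷ A) (b ∷ B) zero    = refl
coeff-⊕ (a ∷ A) (b ∷ B) (suc k) = coeff-⊕ A B k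

coeff-scale : ∀ c B k → coeff (map (c *_) B) k ≡ c * coeff B k
coeff-scale c []      k       = sym (*-zeroʳ c)
coeff-scale c (b ∷ B) zero    = refl
coeff-scale c (b ∷ B) (suc k) = coeff-scale c B k

coeff-∷⊗ : ∀ c A B k → coeff ((c ∷ A) ⊗ B) k ≡ c * coeff B k + shifted 1 (A ⊗ B) k
coeff-∷⊗ c A B k = trans (coeff-⊕ (map (c *_) B) (0 ∷ (A ⊗ B)) k) (cong₂ _+_ (coeff-scale c B k) (coeff-0∷ k))
  where
  coeff-0∷ : ∀ k → coeff (0 ∷ (A ⊗ B)) k ≡ shifted 1 (A ⊗ B) k
  coeff-0∷ zero    = refl
  coeff-0∷ (suc k) = refl

coeff-⊕⊗ : ∀ A B K k → coeff ((A ⊕ B) ⊗ K) k ≡ coeff (A ⊗ K) k + coeff (B ⊗ K) k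
coeff-⊕⊗ []      B       K k       = refl
coeff-⊕⊗ (a ∷ A) []      K k       = sym (+-identityʳ _)
coeff-⊕⊗ (a ∷ A) (b ∷ B) K k = begin
  coeff (((a + b) ∷ (A ⊕ B)) ⊗ K) k                                  ≡⟨ coeff-∷⊗ (a + b) (A ⊕ B) K k ⟩
  (a + b) * coeff K k + shifted 1 ((A ⊕ B) ⊗ K) k                    ≡⟨ cong ((a + b) * coeff K k +_) (tails k) ⟩
  (a + b) * coeff K k + (shifted 1 (A ⊗ K) k + shifted 1 (B ⊗ K) k)  ≡⟨ cong (_+ (shifted 1 (A ⊗ K) k + shifted 1 (B ⊗ K) k)) (*-distribʳ-+ (coeff K k) a b) ⟩
  (a * coeff K k + b * coeff K k) + (shifted 1 (A ⊗ K) k + shifted 1 (B ⊗ K) k)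
    ≡⟨ interchange (a * coeff K k) (b * coeff K k) _ _ ⟩
  (a * coeff K k + shifted 1 (A ⊗ K) k) + (b * coeff K k + shifted 1 (B ⊗ K) k)
    ≡⟨ sym (cong₂ _+_ (coeff-∷⊗ a A K k) (coeff-∷⊗ b B K k)) ⟩
  coeff ((a ∷ A) ⊗ K) k + coeff ((b ∷ B) ⊗ K) k                      ∎
  where
  open ≡-Reasoning
  tails : ∀ k → shifted 1 ((A ⊕ B) ⊗ K) k ≡ shifted 1 (A ⊗ K) k + shifted 1 (B ⊗ K) k
  tails zero    = refl
  tails (suc k) = coeff-⊕⊗ A B K k

shifted-suc : ∀ m P X → (∀ j → coeff X j ≡ shifted m P j) → ∀ k → shifted 1 X k ≡ shifted (suc m) P k
shifted-suc m P X X≗ zero    = refl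
shifted-suc m P X X≗ (suc k) = X≗ k

coeff-mon-⊗ : ∀ m P k → coeff (mon m ⊗ P) k ≡ shifted m P k
coeff-mon-⊗ zero    P k = trans (coeff-∷⊗ 1 [] P k) (trans (cong₂ _+_ (*-identityˡ (coeff P k)) (shifted-[] 1 k)) (+-identityʳ _))
coeff-mon-⊗ (suc m) P k = trans (coeff-∷⊗ 0 (mon m) P k) (shifted-suc m P (mon m ⊗ P) (coeff-mon-⊗ m P) k)

coeff-mon : ∀ m k → coeff (mon m) k ≡ shifted m [ 1 ] k
coeff-mon zero    k       = refl
coeff-mon (suc m) zero    = refl
coeff-mon (suc m) (suc k) = coeff-mon m k

coeff-⊗-mon : ∀ A m k → coeff (A ⊗ mon m) k ≡ shifted m A k
coeff-⊗-mon []      m k = sym (shifted-[] m k)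
coeff-⊗-mon (c ∷ A) m k = begin
  coeff ((c ∷ A) ⊗ mon m) k                                ≡⟨ coeff-∷⊗ c A (mon m) k ⟩
  c * coeff (mon m) k + shifted 1 (A ⊗ mon m) k           ≡⟨ cong₂ _+_ (cong (c *_) (coeff-mon m k)) (shifted-suc m A (A ⊗ mon m) (coeff-⊗-mon A m) k) ⟩
  c * shifted m [ 1 ] k + shifted (suc m) A k             ≡⟨ sym (shifted-∷ m k) ⟩
  shifted m (c ∷ A) k                                     ∎
  where
  open ≡-Reasoning
  shifted-∷ : ∀ m k → shifted m (c ∷ A) k ≡ c * shifted m [ 1 ] k + shifted (suc m) A k
  shifted-∷ zero    zero    = sym (trans (+-identityʳ _) (*-identityʳ c))
  shifted-∷ zero    (suc k) = sym (cong (_+ coeff A k) (*-zeroʳ c))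
  shifted-∷ (suc m) zero    = sym (trans (+-identityʳ _) (*-zeroʳ c))
  shifted-∷ (suc m) (suc k) = shifted-∷ m k

exponents : ℕ → ℕ → List ℕ
exponents zero    q = []
exponents (suc a) q = exponents a q ++ [ q ^ suc a ∸ 2 ]

coeff-fPoly-⊗ : ∀ a q P k → coeff (fPoly a q ⊗ P) k ≡ eval (exponents a q) (λ x → shifted x P k)
coeff-fPoly-⊗ zero    q P k = refl
coeff-fPoly-⊗ (suc a) q P k = begin
  coeff ((fPoly a q ⊕ mon m) ⊗ P) k                                ≡⟨ coeff-⊕⊗ (fPoly a q) (mon m) P k ⟩
  coeff (fPoly a q ⊗ P) k + coeff (mon m ⊗ P) k                    ≡⟨ cong₂ _+_ (coeff-fPoly-⊗ a q P k) (trans (coeff-mon-⊗ m P k) (sym (+-identityʳ _))) ⟩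
  eval (exponents a q) (λ x → shifted x P k) + (shifted m P k + 0) ≡⟨ sym (eval-++ (exponents a q) [ m ] _) ⟩
  eval (exponents a q ++ [ m ]) (λ x → shifted x P k)              ∎
  where
  open ≡-Reasoning
  m : ℕ
  m = q ^ suc a ∸ 2

coeff-fPoly-^ : ∀ a q N k → coeff (fPoly a q ^ₚ N) k ≡ eval (exponents a q ^ₗ N) (indicator k)
coeff-fPoly-^ a q zero    zero    = refl
coeff-fPoly-^ a q zero    (suc k) = refl
coeff-fPoly-^ a q (suc N) k = begin
  coeff (fPoly a q ⊗ (fPoly a q ^ₚ N)) k                                         ≡⟨ coeff-fPoly-⊗ a q _ k ⟩
  eval (exponents a q) (λ x → shifted x (fPoly a q ^ₚ N) k)                      ≡⟨ eval-cong (exponents a q) (λ x → shifted-indicator x k) ⟩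
  eval (exponents a q) (λ x → eval (exponents a q ^ₗ N) (λ y → indicator k (x + y))) ≡⟨ sym (eval-⊛ (exponents a q) _ (indicator k)) ⟩
  eval (exponents a q ^ₗ suc N) (indicator k)                                     ∎
  where
  open ≡-Reasoning
  shifted-indicator : ∀ x k → shifted x (fPoly a q ^ₚ N) k ≡ eval (exponents a q ^ₗ N) (λ y → indicator k (x + y))
  shifted-indicator zero    k       = coeff-fPoly-^ a q N k
  shifted-indicator (suc x) zero    = sym (eval-zero (exponents a q ^ₗ N))
  shifted-indicator (suc x) (suc k) = shifted-indicator x k

-- Reduction modulo X^n - X with n = M + 1 ≥ 2: since X^n ≡ X, the
-- coefficient of X^M in the remainder of A is the sum of the coefficients of A
-- at the positive multiples (u+1)·M of M (all u < B + 1, for B large).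
remainder-top-coeff : ∀ p .{{_ : NonZero p}} M' A R → IsRemainder p (suc (suc M')) A R →
  ∃ λ B₀ → ∀ B → B₀ ≤ B → coeff R (suc M') % p ≡ ∑< (suc B) (λ u → coeff A (suc u * suc M')) % p
remainder-top-coeff p M' A R (length≤ , Q , A≡) = length Q , top≡sum
  where
  open ≡-Reasoning
  M : ℕ
  M = suc M'
  n : ℕ
  n = suc M
  a : ℕ → ℕ
  a u = coeff A (suc u * M)
  -- coefficient of Q at the exponent that X^n · Q sends to (u+1)·M
  d : ℕ → ℕ
  d u = coeff Q (M' + u * M)

  A≡ₖ : ∀ k → (coeff A k + shifted 1 Q k) % p ≡ (shifted n Q k + coeff R k) % p
  A≡ₖ k = begin
    (coeff A k + shifted 1 Q k) % p          ≡⟨ cong (λ z → (coeff A k + z) % p) (sym (coeff-⊗-mon Q 1 k)) ⟩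
    (coeff A k + coeff (Q ⊗ mon 1) k) % p    ≡⟨ cong (_% p) (sym (coeff-⊕ A (Q ⊗ mon 1) k)) ⟩
    coeff (A ⊕ Q ⊗ mon 1) k % p              ≡⟨ A≡ k ⟩
    coeff (Q ⊗ mon n ⊕ R) k % p              ≡⟨ cong (_% p) (coeff-⊕ (Q ⊗ mon n) R k) ⟩
    (coeff (Q ⊗ mon n) k + coeff R k) % p    ≡⟨ cong (λ z → (z + coeff R k) % p) (coeff-⊗-mon Q n k) ⟩
    (shifted n Q k + coeff R k) % p          ∎

  base : (a 0 + d 0) % p ≡ coeff R M % p
  base = begin
    (a 0 + d 0) % p                                                  ≡⟨ A≡ₖ (suc (M' + 0)) ⟩
    (shifted n Q (suc (M' + 0)) + coeff R (suc (M' + 0))) % p        ≡⟨ cong₂ (λ x k → (x + coeff R (suc k)) % p)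
                                                                          (shifted-< n Q _ (s≤s (s≤s (≤-reflexive (+-identityʳ M'))))) (+-identityʳ M') ⟩
    coeff R M % p                                                    ∎

  -- at exponent (u+2)·M, beyond the degree of R:  a (u+1) + d (u+1) ≡ d u
  step : ∀ u → (a (suc u) + d (suc u)) % p ≡ d u % p
  step u = begin
    (a (suc u) + d (suc u)) % p                                                  ≡⟨ A≡ₖ (suc (M' + suc u * M)) ⟩
    (shifted n Q (suc (M' + suc u * M)) + coeff R (suc (M' + suc u * M))) % p    ≡⟨ cong₂ (λ x y → (x + y) % p) shifted≡ R≡0 ⟩
    (d u + 0) % p                                                                ≡⟨ cong (_% p) (+-identityʳ _) ⟩
    d u % p                                                                      ∎
    where
    shifted≡ : shifted n Q (suc (M' + suc u * M)) ≡ d u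
    shifted≡ = trans (cong (λ k → shifted n Q (suc k)) (x∙yz≈y∙xz M' M (u * M))) (shifted-+ n Q (M' + u * M))
    R≡0 : coeff R (suc (M' + suc u * M)) ≡ 0
    R≡0 = coeff-beyond R _ (≤-trans length≤ (s≤s (≤-trans (m≤m+n M (u * M)) (m≤n+m (M + u * M) M'))))

  telescope : ∀ B → (∑< (suc B) a + d B) % p ≡ coeff R M % p
  telescope zero    = trans (cong (λ z → (z + d 0) % p) (+-identityʳ (a 0))) base
  telescope (suc B) = begin
    (∑< (suc (suc B)) a + d (suc B)) % p      ≡⟨ cong (λ z → (z + d (suc B)) % p) (∑<-suc (suc B) a) ⟩
    (∑< (suc B) a + a (suc B) + d (suc B)) % p ≡⟨ cong (_% p) (+-assoc (∑< (suc B) a) _ _) ⟩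
    (∑< (suc B) a + (a (suc B) + d (suc B))) % p ≡⟨ +-congˡ-% p (∑< (suc B) a) (step B) ⟩
    (∑< (suc B) a + d B) % p                  ≡⟨ telescope B ⟩
    coeff R M % p                             ∎

  top≡sum : ∀ B → length Q ≤ B → coeff R M % p ≡ ∑< (suc B) a % p
  top≡sum B length≤B = begin
    coeff R M % p                ≡⟨ sym (telescope B) ⟩
    (∑< (suc B) a + d B) % p     ≡⟨ cong (λ z → (∑< (suc B) a + z) % p) (coeff-beyond Q _ (≤-trans length≤B (≤-trans (m≤m*n B M) (m≤n+m (B * M) M')))) ⟩
    (∑< (suc B) a + 0) % p       ≡⟨ cong (_% p) (+-identityʳ _) ⟩
    ∑< (suc B) a % p             ∎

multiplesOf : ℕ → ℕ → ℕ → ℕ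
multiplesOf M n x = ∑< n (λ u → indicator (suc u * M) x)

multiplesOf-other : ∀ M n x → (∀ t → x ≢ t * M) → multiplesOf M n x ≡ 0
multiplesOf-other M n x x≢ = ∑<-zero n _ (λ u _ → cong (λ b → if b then 1 else 0) (≡ᵇ-false (x≢ (suc u))))

multiplesOf-multiple : ∀ M n r → .{{NonZero M}} → 0 < r → r ≤ n → multiplesOf M n (r * M) ≡ 1
multiplesOf-multiple M n (suc r) _ r<n =
  trans (∑<-single n r _ r<n other) (cong (λ b → if b then 1 else 0) (≡ᵇ-true {suc r * M} refl))
  where
  other : ∀ u → u ≢ r → indicator (suc u * M) (suc r * M) ≡ 0
  other u u≢r = cong (λ b → if b then 1 else 0) (≡ᵇ-false (λ eq → u≢r (suc-injective (*-cancelʳ-≡ _ _ M (sym eq)))))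

∑<-eval : ∀ n L (g : ℕ → ℕ → ℕ) → ∑< n (λ u → eval L (g u)) ≡ eval L (λ x → ∑< n (λ u → g u x))
∑<-eval zero    L g = sym (eval-zero L)
∑<-eval (suc n) L g = trans (cong (eval L (g 0) +_) (∑<-eval n L (λ u → g (suc u))))
  (sym (eval-+ L (g 0) (λ x → ∑< n (λ u → g (suc u) x))))

digits-unique : ∀ q x x' y y' → x < q → x' < q → x + q * y ≡ x' + q * y' → x ≡ x' × y ≡ y'
digits-unique q@(suc _) x x' y y' x<q x'<q eq = x≡x' , y≡y'
  where
  low-digit : ∀ x y → x < q → (x + q * y) % q ≡ x
  low-digit x y x<q = trans (cong (λ z → (x + z) % q) (*-comm q y)) (trans ([m+kn]%n≡m%n x y q) (m<n⇒m%n≡m x<q))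
  x≡x' : x ≡ x'
  x≡x' = trans (sym (low-digit x y x<q)) (trans (cong (_% q) eq) (low-digit x' y' x'<q))
  y≡y' : y ≡ y'
  y≡y' = *-cancelˡ-≡ y y' q (+-cancelˡ-≡ x _ _ (trans eq (cong (_+ q * y') (sym x≡x'))))

module MultipleOfM (q E M r b c u W S X : ℕ)
  (3≤q : 3 ≤ q) (q≤E : q ≤ E) (qE≡1+M : q * E ≡ suc M) (r<q : r < q) (0<r : 0 < r)
  (b+c≡r : b + c ≡ r) (qu≤cE : q * u ≤ c * E) (qW+E≤qE : q * W + E ≤ q * E)
  (D+2≤qE : r + q * S + 2 ≤ q * E) (0<S : 0 < S)
  (X+D≡ : X + (r + q * S) ≡ b * (q * E) + q * u + q * W) where

  private instance
    q≢0 : NonZero q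
    q≢0 = >-nonZero (≤-trans (s≤s z≤n) 3≤q)

  D : ℕ
  D = r + q * S
  -- the "carry" left after removing b·M
  Z : ℕ
  Z = b + q * u + q * W

  b≤r : b ≤ r
  b≤r = subst (b ≤_) b+c≡r (m≤m+n b c)

  b<q : b < q
  b<q = ≤-<-trans b≤r r<q

  c≡0⇒u≡0 : c ≡ 0 → u ≡ 0
  c≡0⇒u≡0 c≡0 = *-cancelˡ-≡ u 0 q (trans (n≤0⇒n≡0 (subst (λ z → q * u ≤ z * E) c≡0 qu≤cE)) (sym (*-zeroʳ q)))

  Z≡ : Z ≡ b + q * (u + W)
  Z≡ = trans (+-assoc b (q * u) (q * W)) (cong (b +_) (sym (*-distribˡ-+ q u W)))

  X+D≡bM+Z : X + D ≡ b * M + Z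
  X+D≡bM+Z = trans X+D≡ (trans (cong (λ z → b * z + q * u + q * W) qE≡1+M) (regroup b M (q * u) (q * W)))
    where
    regroup : ∀ b M U V → b * suc M + U + V ≡ b * M + (b + U + V)
    regroup = solve 4 (λ b M U V → b :* (con 1 :+ M) :+ U :+ V := b :* M :+ (b :+ U :+ V)) refl

  D<M : D < M
  D<M = s≤s⁻¹ (subst₂ _≤_ (+-comm D 2) qE≡1+M D+2≤qE)

  Z+2≤2M : Z + 2 ≤ M + M
  Z+2≤2M = s≤s⁻¹ (s≤s⁻¹ (subst₂ _≤_ (shift Z) (double M qE≡1+M)
             (+-cancelʳ-≤ (E + E) (Z + 4) (q * E + q * E) (subst (_≤ (q * E + q * E) + (E + E)) (swap Z (E + E)) bound))))
    where
    [1+r][1+E]≤q[1+E] : r * E + r + E + 1 ≤ q * E + q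
    [1+r][1+E]≤q[1+E] = subst₂ _≤_ (expand r E) (expandʳ q E) (*-monoˡ-≤ (suc E) r<q)
      where
      expand : ∀ r E → suc r * suc E ≡ r * E + r + E + 1
      expand = solve 2 (λ r E → (con 1 :+ r) :* (con 1 :+ E) := r :* E :+ r :+ E :+ con 1) refl
      expandʳ : ∀ q E → q * suc E ≡ q * E + q
      expandʳ = solve 2 (λ q E → q :* (con 1 :+ E) := q :* E :+ q) refl
    q+3≤2E : q + 3 ≤ E + E
    q+3≤2E = subst (_≤ E + E) (+-comm 3 q) (+-mono-≤ (≤-trans 3≤q q≤E) q≤E)
    qu≤rE : q * u ≤ r * E
    qu≤rE = ≤-trans qu≤cE (*-monoˡ-≤ E (subst (c ≤_) b+c≡r (m≤n+m c b)))
    bound : Z + (E + E) + 4 ≤ (q * E + q * E) + (E + E)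
    bound = begin
      Z + (E + E) + 4                              ≤⟨ +-monoˡ-≤ 4 (+-monoˡ-≤ (E + E) (+-mono-≤ (+-mono-≤ b≤r qu≤rE) (≤-refl {q * W}))) ⟩
      r + r * E + q * W + (E + E) + 4              ≡⟨ regroup r (r * E) (q * W) E ⟩
      (r * E + r + E + 1) + (q * W + E) + 3        ≤⟨ +-monoˡ-≤ 3 (+-mono-≤ [1+r][1+E]≤q[1+E] qW+E≤qE) ⟩
      (q * E + q) + q * E + 3                      ≡⟨ regroup' (q * E) q ⟩
      (q * E + q * E) + (q + 3)                    ≤⟨ +-monoʳ-≤ (q * E + q * E) q+3≤2E ⟩
      (q * E + q * E) + (E + E)                    ∎
      where
      open ≤-Reasoning
      regroup : ∀ r rE qW E → r + rE + qW + (E + E) + 4 ≡ (rE + r + E + 1) + (qW + E) + 3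
      regroup = solve 4 (λ r rE qW E → r :+ rE :+ qW :+ (E :+ E) :+ con 4 := (rE :+ r :+ E :+ con 1) :+ (qW :+ E) :+ con 3) refl
      regroup' : ∀ x q → x + q + x + 3 ≡ (x + x) + (q + 3)
      regroup' = solve 2 (λ x q → x :+ q :+ x :+ con 3 := (x :+ x) :+ (q :+ con 3)) refl
    shift : ∀ Z → Z + 4 ≡ suc (suc (Z + 2))
    shift = solve 1 (λ Z → Z :+ con 4 := con 2 :+ (Z :+ con 2)) refl
    double : ∀ M → q * E ≡ suc M → q * E + q * E ≡ suc (suc (M + M))
    double M qE≡ rewrite qE≡ = cong suc (+-suc M M)
    swap : ∀ Z E → Z + E + 4 ≡ Z + 4 + E
    swap = solve 2 (λ Z E → Z :+ E :+ con 4 := Z :+ con 4 :+ E) refl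

  exact : b ≡ r → W ≡ S → X ≡ r * M
  exact b≡r W≡S = +-cancelʳ-≡ D X (r * M) (trans X+D≡bM+Z (trans (cong (b * M +_) Z≡D) (cong (λ z → z * M + D) b≡r)))
    where
    Z≡D : Z ≡ D
    Z≡D = begin
      b + q * u + q * W    ≡⟨ cong₂ (λ x y → b + q * x + q * y) (c≡0⇒u≡0 c≡0) W≡S ⟩
      b + q * 0 + q * S    ≡⟨ cong (λ z → b + z + q * S) (*-zeroʳ q) ⟩
      b + 0 + q * S        ≡⟨ cong (_+ q * S) (trans (+-identityʳ b) b≡r) ⟩
      D                    ∎
      where
      open ≡-Reasoning
      c≡0 : c ≡ 0
      c≡0 = +-cancelˡ-≡ b c 0 (trans b+c≡r (trans (sym b≡r) (sym (+-identityʳ b))))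

  -- X = (b + d)·M forces d = 0, and then the digits of D = Z agree.
  no-carry : D ≡ Z → b ≡ r × W ≡ S
  no-carry D≡Z with digits-unique q r b S (u + W) r<q b<q (trans D≡Z Z≡)
  ... | r≡b , S≡u+W = sym r≡b , sym (trans S≡u+W (cong (_+ W) u≡0))
    where
    u≡0 : u ≡ 0
    u≡0 = c≡0⇒u≡0 (+-cancelˡ-≡ b c 0 (trans b+c≡r (trans r≡b (sym (+-identityʳ b)))))

  -- one extra M moves a carry into the q-digit: r + q(E + S) = (b + 1) + q(u + W)
  carried : M + 0 + D ≡ Z → r + q * (E + S) ≡ suc b + q * (u + W)
  carried M+D≡Z = begin
    r + q * (E + S)           ≡⟨ cong (r +_) (*-distribˡ-+ q E S) ⟩
    r + (q * E + q * S)       ≡⟨ cong (λ z → r + (z + q * S)) qE≡1+M ⟩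
    r + (suc M + q * S)       ≡⟨ regroup r M (q * S) ⟩
    suc (M + 0 + (r + q * S)) ≡⟨ cong suc (trans M+D≡Z Z≡) ⟩
    suc b + q * (u + W)       ∎
    where
    open ≡-Reasoning
    regroup : ∀ r M x → r + (suc M + x) ≡ suc (M + 0 + (r + x))
    regroup = solve 3 (λ r M x → r :+ (con 1 :+ M :+ x) := con 1 :+ (M :+ con 0 :+ (r :+ x))) refl

  one-carry-impossible : M + 0 + D ≡ Z → ⊥
  one-carry-impossible M+D≡Z with m≤n⇒m<n∨m≡n b<q
  ... | inj₂ 1+b≡q = 0<r⇒⊥ (proj₁ (digits-unique q r 0 (E + S) (suc (u + W)) r<q (≤-trans (s≤s z≤n) 3≤q) eq₀))
    where
    0<r⇒⊥ : r ≡ 0 → ⊥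
    0<r⇒⊥ r≡0 = <-irrefl refl (subst (0 <_) r≡0 0<r)
    eq₀ : r + q * (E + S) ≡ 0 + q * suc (u + W)
    eq₀ = trans (carried M+D≡Z) (trans (cong (λ z → z + q * (u + W)) 1+b≡q) (sym (*-suc q (u + W))))
  ... | inj₁ 1+b<q with digits-unique q r (suc b) (E + S) (u + W) r<q 1+b<q (carried M+D≡Z)
  ...   | r≡1+b , E+S≡u+W = <-irrefl refl (begin-strict
    q * E              <⟨ m<m+n (q * E) (≤-trans (s≤s z≤n) (subst (3 ≤_) (sym (*-identityʳ q)) 3≤q)) ⟩
    q * E + q * 1      ≤⟨ +-monoʳ-≤ (q * E) (*-monoʳ-≤ q 0<S) ⟩
    q * E + q * S      ≡⟨ sym (*-distribˡ-+ q E S) ⟩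
    q * (E + S)        ≡⟨ cong (q *_) E+S≡u+W ⟩
    q * (u + W)        ≡⟨ *-distribˡ-+ q u W ⟩
    q * u + q * W      ≤⟨ +-monoˡ-≤ (q * W) qu≤E ⟩
    E + q * W          ≡⟨ +-comm E (q * W) ⟩
    q * W + E          ≤⟨ qW+E≤qE ⟩
    q * E              ∎)
    where
    open ≤-Reasoning
    c≡1 : c ≡ 1
    c≡1 = +-cancelˡ-≡ b c 1 (trans b+c≡r (trans r≡1+b (+-comm 1 b)))
    qu≤E : q * u ≤ E
    qu≤E = subst (q * u ≤_) (+-identityʳ E) (subst (λ z → q * u ≤ z * E) c≡1 qu≤cE)
  -- the carry d = X/M - b is 0, since 1 and ≥ 2 are excluded
  carry-zero : ∀ d → d * M + D ≡ Z → b ≡ r × W ≡ S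
  carry-zero zero                e = no-carry e
  carry-zero (suc zero)          e = ⊥-elim (one-carry-impossible e)
  carry-zero (suc (suc d))       e = ⊥-elim (<-irrefl (sym e) (begin-strict
    Z                         <⟨ ≤-trans (n≤1+n (suc Z)) (subst (_≤ M + M) (+-comm Z 2) Z+2≤2M) ⟩
    M + M                     ≤⟨ +-monoʳ-≤ M (m≤m+n M (d * M)) ⟩
    M + (M + d * M)           ≤⟨ m≤m+n _ D ⟩
    M + (M + d * M) + D       ∎))
    where open ≤-Reasoning

  carry-of : ∀ t d → X ≡ t * M → b + d ≡ t → b ≡ r × W ≡ S
  carry-of t d X≡tM b+d≡t = carry-zero d (+-cancelˡ-≡ (b * M) _ _ (begin
    b * M + (d * M + D)    ≡⟨ sym (+-assoc (b * M) (d * M) D) ⟩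
    b * M + d * M + D      ≡⟨ cong (_+ D) (trans (sym (*-distribʳ-+ M b d)) (cong (_* M) b+d≡t)) ⟩
    t * M + D              ≡⟨ cong (_+ D) (sym X≡tM) ⟩
    X + D                  ≡⟨ X+D≡bM+Z ⟩
    b * M + Z              ∎))
    where open ≡-Reasoning

  only : ∀ t → X ≡ t * M → b ≡ r × W ≡ S
  only t X≡tM with <-cmp t b
  ... | tri< t<b _ _ = ⊥-elim (<-irrefl tM+D≡bM+Z (begin-strict
    t * M + D          <⟨ +-monoʳ-< (t * M) D<M ⟩
    t * M + M          ≡⟨ +-comm (t * M) M ⟩
    suc t * M          ≤⟨ *-monoˡ-≤ M t<b ⟩
    b * M              ≤⟨ m≤m+n (b * M) Z ⟩
    b * M + Z          ∎))
    where
    open ≤-Reasoning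
    tM+D≡bM+Z : t * M + D ≡ b * M + Z
    tM+D≡bM+Z = trans (cong (_+ D) (sym X≡tM)) X+D≡bM+Z
  ... | tri≈ _ t≡b _ = carry-of t (t ∸ b) X≡tM (m+[n∸m]≡n (≤-reflexive (sym t≡b)))
  ... | tri> _ _ b<t = carry-of t (t ∸ b) X≡tM (m+[n∸m]≡n (<⇒≤ b<t))

q≤q^[1+n] : ∀ q n → 1 ≤ q → q ≤ q ^ suc n
q≤q^[1+n] q n 1≤q = m≤m*n q (q ^ n) {{m^n≢0 q n {{>-nonZero 1≤q}}}}

-- The exponents P·(q^{i+1} - 2) for off ≤ i < off + a: those of f_{a,q}
-- (P = 1, off = 0) and of f_{a,q}(X^P).
scaledExponents : (q P off a : ℕ) → Vec ℕ a
scaledExponents q P off zero    = []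
scaledExponents q P off (suc a) = P * (q ^ suc off ∸ 2) ∷ scaledExponents q P (suc off) a

-- α·(exponents) + 2P·Σα = P q^{off+1} · Σ α_i q^{i-1}: the exponents are
-- P q^i minus the correction 2P.
dot-scaledExponents : ∀ q P off {a} (α : Vec ℕ a) → 2 ≤ q →
  dot α (scaledExponents q P off a) + 2 * P * V.sum α ≡ P * q ^ suc off * weightedSum q α
dot-scaledExponents q P off []       _   = trans (cong (0 +_) (*-zeroʳ (2 * P))) (sym (*-zeroʳ (P * q ^ suc off)))
dot-scaledExponents q P off (x ∷ xs) 2≤q = begin
  x * (P * (Y ∸ 2)) + d + 2 * P * (x + V.sum xs)        ≡⟨ regroup x P (Y ∸ 2) d (V.sum xs) ⟩
  x * (P * (Y ∸ 2 + 2)) + (d + 2 * P * V.sum xs)        ≡⟨ cong₂ (λ u v → x * (P * u) + v) (m∸n+n≡m 2≤Y) (dot-scaledExponents q P (suc off) xs 2≤q) ⟩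
  x * (P * Y) + P * (q * Y) * weightedSum q xs          ≡⟨ factor x P Y q (weightedSum q xs) ⟩
  P * Y * (x + q * weightedSum q xs)                    ∎
  where
  open ≡-Reasoning
  Y : ℕ
  Y = q ^ suc off
  d : ℕ
  d = dot xs (scaledExponents q P (suc off) _)
  2≤Y : 2 ≤ Y
  2≤Y = ≤-trans 2≤q (q≤q^[1+n] q off (≤-trans (s≤s z≤n) 2≤q))
  regroup : ∀ x P Z d s → x * (P * Z) + d + 2 * P * (x + s) ≡ x * (P * (Z + 2)) + (d + 2 * P * s)
  regroup = solve 5 (λ x P Z d s → x :* (P :* Z) :+ d :+ con 2 :* P :* (x :+ s) := x :* (P :* (Z :+ con 2)) :+ (d :+ con 2 :* P :* s)) refl
  factor : ∀ x P Y q w → x * (P * Y) + P * (q * Y) * w ≡ P * Y * (x + q * w)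
  factor = solve 5 (λ x P Y q w → x :* (P :* Y) :+ P :* (q :* Y) :* w := P :* Y :* (x :+ q :* w)) refl

weightedSum-bound : ∀ q {n} (xs : Vec ℕ n) → 1 ≤ q → q * weightedSum q xs ≤ V.sum xs * q ^ n
weightedSum-bound q []               _   = ≤-reflexive (*-zeroʳ q)
weightedSum-bound q {suc n} (x ∷ xs) 1≤q = begin
  q * (x + q * weightedSum q xs)                    ≡⟨ *-distribˡ-+ q x _ ⟩
  q * x + q * (q * weightedSum q xs)                ≤⟨ +-mono-≤ (≤-reflexive (*-comm q x)) (*-monoʳ-≤ q (weightedSum-bound q xs 1≤q)) ⟩
  x * q + q * (V.sum xs * q ^ n)                    ≤⟨ +-monoˡ-≤ _ (*-monoʳ-≤ x (m≤m*n q (q ^ n) {{m^n≢0 q n {{>-nonZero 1≤q}}}})) ⟩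
  x * (q * q ^ n) + q * (V.sum xs * q ^ n)          ≡⟨ factor x (V.sum xs) q (q ^ n) ⟩
  (x + V.sum xs) * (q * q ^ n)                      ∎
  where
  open ≤-Reasoning
  factor : ∀ x s q Y → x * (q * Y) + q * (s * Y) ≡ (x + s) * (q * Y)
  factor = solve 4 (λ x s q Y → x :* (q :* Y) :+ q :* (s :* Y) := (x :+ s) :* (q :* Y)) refl

eval-exponents : ∀ a q g → eval (exponents a q) g ≡ ∑< a (λ i → g (q ^ suc i ∸ 2))
eval-exponents zero    q g = refl
eval-exponents (suc a) q g = begin
  eval (exponents a q ++ [ q ^ suc a ∸ 2 ]) g                     ≡⟨ eval-++ (exponents a q) _ g ⟩
  eval (exponents a q) g + (g (q ^ suc a ∸ 2) + 0)                ≡⟨ cong₂ _+_ (eval-exponents a q g) (+-identityʳ _) ⟩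
  ∑< a (λ i → g (q ^ suc i ∸ 2)) + g (q ^ suc a ∸ 2)              ≡⟨ sym (∑<-suc a (λ i → g (q ^ suc i ∸ 2))) ⟩
  ∑< (suc a) (λ i → g (q ^ suc i ∸ 2))                            ∎
  where open ≡-Reasoning

eval-scaledExponents : ∀ q P off a g →
  eval (V.toList (scaledExponents q P off a)) g ≡ ∑< a (λ i → g (P * (q ^ suc (off + i) ∸ 2)))
eval-scaledExponents q P off zero    g = refl
eval-scaledExponents q P off (suc a) g = cong₂ _+_
  (cong (λ z → g (P * (q ^ suc z ∸ 2))) (sym (+-identityʳ off)))
  (trans (eval-scaledExponents q P (suc off) a g) (∑<-cong a {λ i → g (P * (q ^ suc (suc off + i) ∸ 2))} (λ i → cong (λ z → g (P * (q ^ suc z ∸ 2))) (sym (+-suc off i)))))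

exponents≈ : ∀ a q → exponents a q ≈ V.toList (scaledExponents q 1 0 a)
exponents≈ a q g = trans (eval-exponents a q g)
  (sym (trans (eval-scaledExponents q 1 0 a g) (∑<-cong a (λ i → cong g (*-identityˡ (q ^ suc i ∸ 2))))))

exponentsᴿ : ℕ → ℕ → (a' : ℕ) → Vec ℕ (suc a')
exponentsᴿ q Q a' = Q * (q ^ suc a' ∸ 2) ∷ scaledExponents q Q 0 a'

scaled-exponents≈ : ∀ a' q Q → map (Q *_) (exponents (suc a') q) ≈ V.toList (exponentsᴿ q Q a')
scaled-exponents≈ a' q Q g = begin
  eval (map (Q *_) (exponents (suc a') q)) g       ≡⟨ eval-map (Q *_) (exponents (suc a') q) g ⟩
  eval (exponents (suc a') q) (λ y → g (Q * y))    ≡⟨ eval-exponents (suc a') q _ ⟩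
  ∑< (suc a') G                                    ≡⟨ ∑<-suc a' G ⟩
  ∑< a' G + G a'                                   ≡⟨ +-comm (∑< a' G) _ ⟩
  G a' + ∑< a' G                                   ≡⟨ cong (G a' +_) (sym (eval-scaledExponents q Q 0 a' g)) ⟩
  eval (V.toList (exponentsᴿ q Q a')) g            ∎
  where
  open ≡-Reasoning
  G : ℕ → ℕ
  G i = g (Q * (q ^ suc i ∸ 2))

cubic-bound : ∀ q P → 3 ≤ q → 1 ≤ P → 2 * (q ∸ 1) * q * P + 2 * (P * (q ∸ 1)) + 2 ≤ q * (P * (q * q))
cubic-bound (suc (suc (suc q₃))) (suc P₁) _ _ =
  subst (lhs ≤_) (sym (expand q₃ P₁)) (m≤m+n lhs _)
  where
  lhs : ℕ
  lhs = 2 * (2 + q₃) * (3 + q₃) * suc P₁ + 2 * (suc P₁ * (2 + q₃)) + 2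
  expand : ∀ q₃ P₁ → (3 + q₃) * (suc P₁ * ((3 + q₃) * (3 + q₃))) ≡
    2 * (2 + q₃) * (3 + q₃) * suc P₁ + 2 * (suc P₁ * (2 + q₃)) + 2 +
    (P₁ * (q₃ * q₃ * q₃ + 7 * (q₃ * q₃) + 15 * q₃ + 11) + (q₃ * q₃ * q₃ + 7 * (q₃ * q₃) + 15 * q₃ + 9))
  expand = solve 2 (λ q₃ P₁ → (con 3 :+ q₃) :* ((con 1 :+ P₁) :* ((con 3 :+ q₃) :* (con 3 :+ q₃))) :=
    con 2 :* (con 2 :+ q₃) :* (con 3 :+ q₃) :* (con 1 :+ P₁) :+ con 2 :* ((con 1 :+ P₁) :* (con 2 :+ q₃)) :+ con 2 :+
    (P₁ :* (q₃ :* q₃ :* q₃ :+ con 7 :* (q₃ :* q₃) :+ con 15 :* q₃ :+ con 11) :+ (q₃ :* q₃ :* q₃ :+ con 7 :* (q₃ :* q₃) :+ con 15 :* q₃ :+ con 9))) refl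
cubic-bound (suc zero)       (suc _) (s≤s ())       _
cubic-bound (suc (suc zero)) (suc _) (s≤s (s≤s ())) _

≤-+-absorb : ∀ q P Y x → 1 ≤ q → x ≤ P * (q ∸ 1) * Y → x + P * Y ≤ q * (P * Y)
≤-+-absorb (suc q₁) P Y x _ x≤ = subst (x + P * Y ≤_) (factor q₁ P Y) (+-monoˡ-≤ (P * Y) x≤)
  where
  factor : ∀ q₁ P Y → P * q₁ * Y + P * Y ≡ suc q₁ * (P * Y)
  factor = solve 3 (λ q₁ P Y → P :* q₁ :* Y :+ P :* Y := (con 1 :+ q₁) :* (P :* Y)) refl

-- The setting of Lemma 6.1 with a = a' + 1 ≥ 2, e - a = T = T' + 1 ≥ 1,
-- Q = q^{e-a}, P = q^{e-a-1}, and 2s = r + q·m.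
module Lemma6-1 (p k q : ℕ) .{{_ : NonZero p}} (prime : Prime p) (q≡p^k : q ≡ p ^ k) (3≤q : 3 ≤ q)
  (a' T' r s m : ℕ) (1≤a' : 1 ≤ a') (0<r : 0 < r) (r<q : r < q)
  (2s≡r+qm : 2 * s ≡ r + q * m) (s≤P[q-1] : s ≤ q ^ T' * (q ∸ 1)) where

  a : ℕ
  a = suc a'
  T : ℕ
  T = suc T'
  e : ℕ
  e = a + T
  P : ℕ
  P = q ^ T'
  Q : ℕ
  Q = q ^ T
  N : ℕ
  N = r * Q + s
  S₂ : ℕ
  S₂ = 2 * r * P + m
  E : ℕ
  E = q ^ (a' + T)
  cᴿ : Vec ℕ (suc a')
  cᴿ = exponentsᴿ q Q a'
  cˢ : Vec ℕ a
  cˢ = scaledExponents q 1 0 a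

  1≤q : 1 ≤ q
  1≤q = ≤-trans (s≤s z≤n) 3≤q

  1≤P : 1 ≤ P
  1≤P = m^n>0 q {{>-nonZero 1≤q}} T'

  M' : ℕ
  M' = q ^ e ∸ 2
  M : ℕ
  M = suc M'

  q^e≡1+M : q ^ e ≡ suc M
  q^e≡1+M = sym (m+[n∸m]≡n (≤-trans (s≤s (s≤s z≤n)) (≤-trans 3≤q (q≤q^[1+n] q (a' + T) 1≤q))))

  -- D = r + q·S₂, the number whose digits are compared with the exponents
  D≡ : r + q * S₂ ≡ 2 * Q * r + 2 * s
  D≡ = trans (expand r q P m) (cong (2 * Q * r +_) (sym 2s≡r+qm))
    where
    expand : ∀ r q P m → r + q * (2 * r * P + m) ≡ 2 * (q * P) * r + (r + q * m)
    expand = solve 4 (λ r q P m → r :+ q :* (con 2 :* r :* P :+ m) := con 2 :* (q :* P) :* r :+ (r :+ q :* m)) refl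

  qE≡q^aQ : q * E ≡ q ^ a * Q
  qE≡q^aQ = ^-distribˡ-+-* q a T

  E≡Pq^a : E ≡ P * q ^ a
  E≡Pq^a = trans (cong (q ^_) (trans (+-suc a' T') (trans (cong suc (+-comm a' T')) (sym (+-suc T' a'))))) (^-distribˡ-+-* q T' a)

  q≤E : q ≤ E
  q≤E = subst (q ≤_) (cong (q ^_) (sym (+-suc a' T'))) (q≤q^[1+n] q (a' + T') 1≤q)

  D+2≤qE : r + q * S₂ + 2 ≤ q * E
  D+2≤qE = begin
    r + q * S₂ + 2                                 ≡⟨ cong (_+ 2) D≡ ⟩
    2 * Q * r + 2 * s + 2                          ≤⟨ +-monoˡ-≤ 2 (+-mono-≤ (*-monoʳ-≤ (2 * Q) r≤q-1) (*-monoʳ-≤ 2 s≤P[q-1])) ⟩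
    2 * Q * (q ∸ 1) + 2 * (P * (q ∸ 1)) + 2        ≡⟨ cong (λ z → z + 2 * (P * (q ∸ 1)) + 2) (reorder q P (q ∸ 1)) ⟩
    2 * (q ∸ 1) * q * P + 2 * (P * (q ∸ 1)) + 2    ≤⟨ cubic-bound q P 3≤q 1≤P ⟩
    q * (P * (q * q))                              ≤⟨ *-monoʳ-≤ q Pq²≤E ⟩
    q * E                                          ∎
    where
    open ≤-Reasoning
    r≤q-1 : r ≤ q ∸ 1
    r≤q-1 = s≤s⁻¹ (subst (r <_) (trans (sym (m∸n+n≡m 1≤q)) (+-comm (q ∸ 1) 1)) r<q)
    reorder : ∀ q P x → 2 * (q * P) * x ≡ 2 * x * q * P
    reorder = solve 3 (λ q P x → con 2 :* (q :* P) :* x := con 2 :* x :* q :* P) refl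
    Pq²≤E : P * (q * q) ≤ E
    Pq²≤E = begin
      P * (q * q)                   ≤⟨ *-monoʳ-≤ P (*-monoʳ-≤ q (q≤q^[1+n] q (a' ∸ 1) 1≤q)) ⟩
      P * (q * q ^ suc (a' ∸ 1))    ≡⟨ cong (λ z → P * (q * q ^ z)) (m+[n∸m]≡n 1≤a') ⟩
      P * q ^ a                     ≡⟨ sym E≡Pq^a ⟩
      E                             ∎

  -- 0 < N < q^e - 1, since 2N + 2 = D + 2 ≤ q^e.
  N<q^e-1 : N < q ^ e ∸ 1
  N<q^e-1 = m+n≤o⇒m≤o∸n (suc N) (≤-trans 2N+2≤ (≤-trans (≤-reflexive (cong (_+ 2) (sym D≡))) D+2≤qE))
    where
    2N+2≤ : suc N + 1 ≤ 2 * Q * r + 2 * s + 2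
    2N+2≤ = subst₂ _≤_ (shift N) (double Q r s) (+-monoˡ-≤ 2 (m≤m+n N N))
      where
      shift : ∀ n → n + 2 ≡ suc n + 1
      shift = solve 1 (λ n → n :+ con 2 := con 1 :+ n :+ con 1) refl
      double : ∀ Q r s → r * Q + s + (r * Q + s) + 2 ≡ 2 * Q * r + 2 * s + 2
      double = solve 3 (λ Q r s → r :* Q :+ s :+ (r :* Q :+ s) :+ con 2 := con 2 :* Q :* r :+ con 2 :* s :+ con 2) refl

  -- The monomials of f(X^Q)^r · f^s are X^{β·cᴿ + α·cˢ} with Σβ = r and
  -- Σα = s.  Such an exponent is a multiple of M exactly for β = (r,0,…,0)
  -- and Σ α_i q^{i-1} = S₂.
  module Exponent (b : ℕ) (β : Vec ℕ a') (α : Vec ℕ a) (Σβ≡r : b + V.sum β ≡ r) (Σα≡s : V.sum α ≡ s) where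
    c : ℕ
    c = V.sum β
    w : ℕ
    w = weightedSum q β
    W : ℕ
    W = weightedSum q α
    X : ℕ
    X = dot (b ∷ β) cᴿ + dot α cˢ

    qQw≤cE : q * (Q * w) ≤ c * E
    qQw≤cE = begin
      q * (Q * w)        ≡⟨ swap q Q w ⟩
      Q * (q * w)        ≤⟨ *-monoʳ-≤ Q (weightedSum-bound q β 1≤q) ⟩
      Q * (c * q ^ a')   ≡⟨ reorder Q c (q ^ a') ⟩
      c * (q ^ a' * Q)   ≡⟨ cong (c *_) (sym (^-distribˡ-+-* q a' T)) ⟩
      c * E              ∎
      where
      open ≤-Reasoning
      swap : ∀ x y z → x * (y * z) ≡ y * (x * z)
      swap = solve 3 (λ x y z → x :* (y :* z) := y :* (x :* z)) refl
      reorder : ∀ Q c Y → Q * (c * Y) ≡ c * (Y * Q)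
      reorder = solve 3 (λ Q c Y → Q :* (c :* Y) := c :* (Y :* Q)) refl

    -- q·W ≤ s·q^a ≤ P(q-1)q^a = qE - E
    qW+E≤qE : q * W + E ≤ q * E
    qW+E≤qE = subst (λ z → q * W + z ≤ q * z) (sym E≡Pq^a)
      (≤-+-absorb q P (q ^ a) (q * W) 1≤q qW≤)
      where
      qW≤ : q * W ≤ P * (q ∸ 1) * q ^ a
      qW≤ = ≤-trans (weightedSum-bound q α 1≤q) (subst (λ z → z * q ^ a ≤ P * (q ∸ 1) * q ^ a) (sym Σα≡s) (*-monoˡ-≤ (q ^ a) s≤P[q-1]))

    0<S₂ : 0 < S₂
    0<S₂ = ≤-trans (*-mono-≤ (*-mono-≤ (s≤s (z≤n {1})) 0<r) 1≤P) (m≤m+n (2 * r * P) m)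

    X+D≡ : X + (r + q * S₂) ≡ b * (q * E) + q * (Q * w) + q * W
    X+D≡ = begin
      X + (r + q * S₂)                                                        ≡⟨ cong (X +_) (trans D≡ (cong₂ (λ u v → 2 * Q * u + 2 * v) (sym Σβ≡r) (sym Σα≡s))) ⟩
      b * (Q * Z) + dᴿ + dˢ + (2 * Q * (b + c) + 2 * V.sum α)                 ≡⟨ regroup b Q Z dᴿ dˢ c (V.sum α) ⟩
      b * (Q * (Z + 2)) + (dᴿ + 2 * Q * c) + (dˢ + 2 * 1 * V.sum α)           ≡⟨ cong₂ _+_ (cong₂ _+_ (cong (λ z → b * (Q * z)) (m∸n+n≡m 2≤q^a)) (dot-scaledExponents q Q 0 β 2≤q)) (dot-scaledExponents q 1 0 α 2≤q) ⟩
      b * (Q * q ^ a) + Q * (q * 1) * w + 1 * (q * 1) * W                     ≡⟨ cong (λ z → b * z + Q * (q * 1) * w + 1 * (q * 1) * W) (trans (*-comm Q (q ^ a)) (sym qE≡q^aQ)) ⟩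
      b * (q * E) + Q * (q * 1) * w + 1 * (q * 1) * W                         ≡⟨ tidy (b * (q * E)) Q q w W ⟩
      b * (q * E) + q * (Q * w) + q * W                                       ∎
      where
      open ≡-Reasoning
      Z : ℕ
      Z = q ^ a ∸ 2
      dᴿ : ℕ
      dᴿ = dot β (scaledExponents q Q 0 a')
      dˢ : ℕ
      dˢ = dot α cˢ
      2≤q : 2 ≤ q
      2≤q = ≤-trans (s≤s (s≤s z≤n)) 3≤q
      2≤q^a : 2 ≤ q ^ a
      2≤q^a = ≤-trans 2≤q (q≤q^[1+n] q a' 1≤q)
      regroup : ∀ b Q Z d₁ d₂ c s → b * (Q * Z) + d₁ + d₂ + (2 * Q * (b + c) + 2 * s)
                                   ≡ b * (Q * (Z + 2)) + (d₁ + 2 * Q * c) + (d₂ + 2 * 1 * s)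
      regroup = solve 7 (λ b Q Z d₁ d₂ c s → b :* (Q :* Z) :+ d₁ :+ d₂ :+ (con 2 :* Q :* (b :+ c) :+ con 2 :* s)
                                          := b :* (Q :* (Z :+ con 2)) :+ (d₁ :+ con 2 :* Q :* c) :+ (d₂ :+ con 2 :* con 1 :* s)) refl
      tidy : ∀ B Q q w W → B + Q * (q * 1) * w + 1 * (q * 1) * W ≡ B + q * (Q * w) + q * W
      tidy = solve 5 (λ B Q q w W → B :+ Q :* (q :* con 1) :* w :+ con 1 :* (q :* con 1) :* W := B :+ q :* (Q :* w) :+ q :* W) refl

    open MultipleOfM q E M r b c (Q * w) W S₂ X 3≤q q≤E q^e≡1+M r<q 0<r Σβ≡r qQw≤cE qW+E≤qE D+2≤qE 0<S₂ X+D≡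
      using (exact; only) public

  f : List ℕ
  f = exponents a q
  fᴿ : List ℕ
  fᴿ = map (Q *_) f

  -- Frobenius: f^N = (f^Q)^r · f^s ≡ f(X^Q)^r · f^s in 𝔽_p[X], as Q is a power of p.
  frobenius-reduction : f ^ₗ N ∼[ p ] fᴿ ^ₗ r ⊛ f ^ₗ s
  frobenius-reduction h = trans (cong (_% p) (trans (^-homo-* f (r * Q) s h) (⊛-cong {f ^ₗ (r * Q)} {(f ^ₗ Q) ^ₗ r} {f ^ₗ s} {f ^ₗ s} f^rQ≈ (λ _ → refl) h)))
    (⊛-cong-% p {(f ^ₗ Q) ^ₗ r} {fᴿ ^ₗ r} {f ^ₗ s} {f ^ₗ s} (^-cong-% p {f ^ₗ Q} {fᴿ} r f^Q∼fᴿ) (λ _ → refl) h)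
    where
    f^rQ≈ : f ^ₗ (r * Q) ≈ (f ^ₗ Q) ^ₗ r
    f^rQ≈ g = trans (^-congʳ f (*-comm r Q) g) (sym (^-assocʳ f Q r g))
    p^[kT]≡Q : p ^ (k * T) ≡ Q
    p^[kT]≡Q = trans (sym (^-*-assoc p k T)) (cong (_^ T) (sym q≡p^k))
    f^Q∼fᴿ : f ^ₗ Q ∼[ p ] fᴿ
    f^Q∼fᴿ = subst (λ z → f ^ₗ z ∼[ p ] map (z *_) f) p^[kT]≡Q (frobenius-^ prime (k * T) f)

  v : Vec ℕ a
  v = r ∷ V.replicate a' 0

  Σv≡r : r + V.sum (V.replicate a' 0) ≡ r
  Σv≡r = trans (cong (r +_) (sum-zeros a')) (+-identityʳ r)
    where
    sum-zeros : ∀ n → V.sum (V.replicate n 0) ≡ 0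
    sum-zeros zero    = refl
    sum-zeros (suc n) = sum-zeros n

  vsum≡sumL : ∀ {n} (xs : Vec ℕ n) → V.sum xs ≡ sumL (V.toList xs)
  vsum≡sumL []       = refl
  vsum≡sumL (x ∷ xs) = cong (x +_) (vsum≡sumL xs)

  module Pairing (B : ℕ) (r≤1+B : r ≤ suc B) where
    h : ℕ → ℕ
    h = multiplesOf M (suc B)

    inner : Vec ℕ a → ℕ
    inner β = sumOver (λ α → multinomial s (V.toList α) * h (dot β cᴿ + dot α cˢ)) (boxVecs a s)

    F : Vec ℕ a → ℕ
    F β = multinomial r (V.toList β) * inner β

    expansion : eval (fᴿ ^ₗ r ⊛ f ^ₗ s) h ≡ sumOver F (boxVecs a r)
    expansion = begin
      eval (fᴿ ^ₗ r ⊛ f ^ₗ s) h                                                ≡⟨ eval-⊛ (fᴿ ^ₗ r) (f ^ₗ s) h ⟩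
      eval (fᴿ ^ₗ r) (λ x → eval (f ^ₗ s) (λ y → h (x + y)))                   ≡⟨ ^-congˡ r (scaled-exponents≈ a' q Q) _ ⟩
      eval (V.toList cᴿ ^ₗ r) (λ x → eval (f ^ₗ s) (λ y → h (x + y)))          ≡⟨ eval-cong (V.toList cᴿ ^ₗ r) (λ x → ^-congˡ s (exponents≈ a q) (λ y → h (x + y))) ⟩
      eval (V.toList cᴿ ^ₗ r) (λ x → eval (V.toList cˢ ^ₗ s) (λ y → h (x + y))) ≡⟨ multinomial-theorem a cᴿ r r ≤-refl _ ⟩
      sumOver (λ β → multinomial r (V.toList β) * eval (V.toList cˢ ^ₗ s) (λ y → h (dot β cᴿ + y))) (boxVecs a r)
        ≡⟨ sumOver-cong (boxVecs a r) (λ β → cong (multinomial r (V.toList β) *_) (multinomial-theorem a cˢ s s ≤-refl (λ y → h (dot β cᴿ + y)))) ⟩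
      sumOver F (boxVecs a r)                                                  ∎
      where open ≡-Reasoning

    F-other : ∀ β → β ≢ v → F β ≡ 0
    F-other (b ∷ β) β≢v with b + V.sum β ≟ r
    ... | no Σβ≢r = cong (_* inner (b ∷ β)) (multinomial-wrong-sum r (b ∷ V.toList β) (λ eq → Σβ≢r (trans (cong (b +_) (vsum≡sumL β)) eq)))
    ... | yes Σβ≡r with b ≟ r
    ...   | yes b≡r = ⊥-elim (β≢v (cong₂ _∷_ b≡r (zeros β (+-cancelˡ-≡ b _ 0 (trans Σβ≡r (trans (sym b≡r) (sym (+-identityʳ b))))))))
      where
      zeros : ∀ {n} (xs : Vec ℕ n) → V.sum xs ≡ 0 → xs ≡ V.replicate n 0
      zeros []       _   = refl
      zeros (x ∷ xs) Σ≡0 = cong₂ _∷_ (m+n≡0⇒m≡0 x Σ≡0) (zeros xs (m+n≡0⇒n≡0 x Σ≡0))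
    ...   | no b≢r = trans (cong (multinomial r (b ∷ V.toList β) *_) (sumOver-zero _ (boxVecs a s) term≡0)) (*-zeroʳ (multinomial r (b ∷ V.toList β)))
      where
      term≡0 : ∀ α → multinomial s (V.toList α) * h (dot (b ∷ β) cᴿ + dot α cˢ) ≡ 0
      term≡0 α with V.sum α ≟ s
      ... | no Σα≢s = cong (_* h (dot (b ∷ β) cᴿ + dot α cˢ)) (multinomial-wrong-sum s (V.toList α) (λ eq → Σα≢s (trans (vsum≡sumL α) eq)))
      ... | yes Σα≡s = trans (cong (multinomial s (V.toList α) *_)
                         (multiplesOf-other M (suc B) _ (λ t eq → b≢r (proj₁ (Exponent.only b β α Σβ≡r Σα≡s t eq)))))
                         (*-zeroʳ (multinomial s (V.toList α)))

    selects : ∀ α → multinomial s (V.toList α) * h (dot v cᴿ + dot α cˢ)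
                  ≡ (if does (T? ((V.sum α ≡ᵇ s) ∧ (weightedSum q α ≡ᵇ S₂))) then multinomial s (V.toList α) else 0)
    selects α with V.sum α ≟ s
    ... | no Σα≢s rewrite ≡ᵇ-false Σα≢s = cong (_* h (dot v cᴿ + dot α cˢ)) (multinomial-wrong-sum s (V.toList α) (λ eq → Σα≢s (trans (vsum≡sumL α) eq)))
    ... | yes Σα≡s rewrite ≡ᵇ-true Σα≡s with weightedSum q α ≟ S₂
    ...   | yes W≡S₂ rewrite ≡ᵇ-true W≡S₂ =
      trans (cong (multinomial s (V.toList α) *_) (trans (cong h (Exponent.exact r (V.replicate a' 0) α Σv≡r Σα≡s refl W≡S₂))
                                                        (multiplesOf-multiple M (suc B) r 0<r r≤1+B)))
            (*-identityʳ _)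
    ...   | no W≢S₂ rewrite ≡ᵇ-false W≢S₂ =
      trans (cong (multinomial s (V.toList α) *_)
              (multiplesOf-other M (suc B) _ (λ t eq → W≢S₂ (proj₂ (Exponent.only r (V.replicate a' 0) α Σv≡r Σα≡s t eq)))))
            (*-zeroʳ (multinomial s (V.toList α)))

    F-v : F v ≡ multinomialSum q a s S₂
    F-v = begin
      F v                                          ≡⟨ cong (_* inner v) (multinomial-concentrated r a') ⟩
      1 * sumOver G (boxVecs a s)                  ≡⟨ *-identityˡ _ ⟩
      sumOver G (boxVecs a s)                      ≡⟨ sumOver-cong (boxVecs a s) selects ⟩
      sumOver (λ α → if does (P? α) then multinomial s (V.toList α) else 0) (boxVecs a s)
                                                   ≡⟨ sym (sumOver-filter P? (λ α → multinomial s (V.toList α)) (boxVecs a s)) ⟩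
      multinomialSum q a s S₂                      ∎
      where
      open ≡-Reasoning
      G : Vec ℕ a → ℕ
      G α = multinomial s (V.toList α) * h (dot v cᴿ + dot α cˢ)
      P? : Decidable (λ α → Bool.T ((V.sum α ≡ᵇ s) ∧ (weightedSum q α ≡ᵇ S₂)))
      P? α = T? ((V.sum α ≡ᵇ s) ∧ (weightedSum q α ≡ᵇ S₂))

    pairing : eval (f ^ₗ N) h % p ≡ multinomialSum q a s S₂ % p
    pairing = begin
      eval (f ^ₗ N) h % p                    ≡⟨ frobenius-reduction h ⟩
      eval (fᴿ ^ₗ r ⊛ f ^ₗ s) h % p          ≡⟨ cong (_% p) expansion ⟩
      sumOver F (boxVecs a r) % p            ≡⟨ cong (_% p) (sumOver-box-single a r F v (≤-refl ∷ all-zero a') F-other) ⟩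
      F v % p                                ≡⟨ cong (_% p) F-v ⟩
      multinomialSum q a s S₂ % p            ∎
      where
      open ≡-Reasoning
      all-zero : ∀ n → All (_≤ r) (V.replicate n 0)
      all-zero zero    = []
      all-zero (suc n) = z≤n ∷ all-zero n

  C-value : CIs p q e a N (multinomialSum q a s S₂)
  C-value R remainder = begin
    coeff R (q ^ e ∸ 1) % p                                         ≡⟨ cong (λ z → coeff R (z ∸ 1) % p) q^e≡1+M ⟩
    coeff R M % p                                                   ≡⟨ proj₂ top B (m≤m+n B₀ r) ⟩
    ∑< (suc B) (λ u → coeff (fPoly a q ^ₚ N) (suc u * M)) % p       ≡⟨ cong (_% p) (∑<-cong (suc B) (λ u → coeff-fPoly-^ a q N (suc u * M))) ⟩
    ∑< (suc B) (λ u → eval (f ^ₗ N) (indicator (suc u * M))) % p    ≡⟨ cong (_% p) (∑<-eval (suc B) (f ^ₗ N) (λ u → indicator (suc u * M))) ⟩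
    eval (f ^ₗ N) (multiplesOf M (suc B)) % p                       ≡⟨ Pairing.pairing B (≤-trans (m≤n+m r B₀) (n≤1+n _)) ⟩
    multinomialSum q a s S₂ % p                                     ∎
    where
    open ≡-Reasoning
    top : ∃ λ B₀ → ∀ B → B₀ ≤ B → coeff R M % p ≡ ∑< (suc B) (λ u → coeff (fPoly a q ^ₚ N) (suc u * M)) % p
    top = remainder-top-coeff p M' (fPoly a q ^ₚ N) R (subst (λ n → IsRemainder p n (fPoly a q ^ₚ N) R) q^e≡1+M remainder)
    B₀ : ℕ
    B₀ = proj₁ top
    B : ℕ
    B = B₀ + r

open import Data.Integer using (+_; _-_) renaming (∣_∣ to absℤ)
open import Data.Integer.Divisibility as ℤ using ()
import Data.Integer.Properties as ℤ

-- 2s ≡ r (mod q) with 0 ≤ r < q means 2s = r + q·m for a natural number m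
-- (2s < r is impossible, since then q would divide 0 < r - 2s < q).
halving-condition : ∀ q r s → r < q → (+ q) ℤ.∣ (+ (2 * s) - + r) → ∃ λ m → 2 * s ≡ r + q * m
halving-condition q r s r<q q∣2s-r with r ≤? 2 * s
... | yes r≤2s = m , trans (sym (m+[n∸m]≡n r≤2s)) (cong (λ z → r + z) (trans (_∣_.equality q∣) (*-comm m q)))
  where
  q∣ : q ∣ 2 * s ∸ r
  q∣ = subst (q ∣_) (cong absℤ (trans (ℤ.[+m]-[+n]≡m⊖n (2 * s) r) (ℤ.⊖-≥ r≤2s))) q∣2s-r
  m : ℕ
  m = _∣_.quotient q∣
... | no r≰2s = ⊥-elim (<-irrefl refl (<-≤-trans r<q (≤-trans (∣⇒≤ {{r-2s≢0}} q∣) (m∸n≤m r (2 * s)))))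
  where
  2s<r : 2 * s < r
  2s<r = ≰⇒> r≰2s
  q∣ : q ∣ r ∸ 2 * s
  q∣ = subst (q ∣_) (trans (cong absℤ (ℤ.[+m]-[+n]≡m⊖n (2 * s) r)) (ℤ.∣⊖∣-< 2s<r)) q∣2s-r
  r-2s≢0 : NonZero (r ∸ 2 * s)
  r-2s≢0 = >-nonZero (m<n⇒0<n∸m 2s<r)

S₂-formula : ∀ q .{{_ : NonZero q}} r s P m → 2 * s ≡ r + q * m → (2 * r * (q * P) + 2 * s ∸ r) / q ≡ 2 * r * P + m
S₂-formula q r s P m 2s≡ = begin
  (2 * r * (q * P) + 2 * s ∸ r) / q            ≡⟨ cong (λ z → (2 * r * (q * P) + z ∸ r) / q) 2s≡ ⟩
  (2 * r * (q * P) + (r + q * m) ∸ r) / q      ≡⟨ cong (λ z → (z ∸ r) / q) (regroup r q P m) ⟩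
  (r + (2 * r * P + m) * q ∸ r) / q            ≡⟨ cong (_/ q) (m+n∸m≡n r _) ⟩
  (2 * r * P + m) * q / q                      ≡⟨ m*n/n≡m (2 * r * P + m) q ⟩
  2 * r * P + m                                ∎
  where
  open ≡-Reasoning
  regroup : ∀ r q P m → 2 * r * (q * P) + (r + q * m) ≡ r + (2 * r * P + m) * q
  regroup = solve 4 (λ r q P m → con 2 :* r :* (q :* P) :+ (r :+ q :* m) := r :+ (con 2 :* r :* P :+ m) :* q) refl

Conclusion : (p q : ℕ) → .{{NonZero p}} → (r s e a t S : ℕ) → Set
Conclusion p q r s e a t S =
  (0 < r * q ^ t + s) × (r * q ^ t + s < q ^ e ∸ 1) × CIs p q e a (r * q ^ t + s) (multinomialSum q a s S)

Conclusion-cong : ∀ p q .{{_ : NonZero p}} r s {e e' a a' t t' S S'} → e ≡ e' → a ≡ a' → t ≡ t' → S ≡ S' →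
  Conclusion p q r s e' a' t' S' → Conclusion p q r s e a t S
Conclusion-cong p q r s refl refl refl refl holds = holds

3≤p^k : ∀ p k → Prime p → p ≢ 2 → 1 ≤ k → 3 ≤ p ^ k
3≤p^k p k prime p≢2 1≤k = ≤-trans 3≤p (subst (λ z → p ≤ p ^ z) (m+[n∸m]≡n 1≤k) (q≤q^[1+n] p (k ∸ 1) (≤-trans (s≤s z≤n) 3≤p)))
  where
  3≤p : 3 ≤ p
  3≤p = ≤∧≢⇒< (nonTrivial⇒n>1 p {{prime⇒nonTrivial prime}}) (λ 2≡p → p≢2 (sym 2≡p))

-- Lemma 6.1.  Write a = a' + 1, e - a = T' + 1 and 2s = r + qm.
lemma6p1 : (p k q : ℕ) → .{{_ : NonZero p}} → .{{_ : NonZero q}} →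
  Prime p → p ≢ 2 → 1 ≤ k → q ≡ p ^ k →
  (e a : ℕ) → 2 ≤ e → 2 ≤ a → a ≤ p * e ∸ 2 → gcd a (p * e) ≡ 1 →
  a + 2 ≤ e → e < 2 * a →
  (r s : ℕ) → 0 < r → r < q → 0 < s →
  (q ∸ 1) ∣ (s + r) →
  (+ q) ℤ.∣ ((+ (2 * s)) - (+ r)) →
  s ≤ q ^ (e ∸ a ∸ 1) * (q ∸ 1) →
  let N = r * q ^ (e ∸ a) + s
      S₂ = (2 * r * q ^ (e ∸ a) + 2 * s ∸ r) / q
  in (0 < N) × (N < q ^ e ∸ 1) × CIs p q e a N (multinomialSum q a s S₂)
lemma6p1 p k q prime p≢2 1≤k q≡p^k e a _ 2≤a _ _ a+2≤e _ r s 0<r r<q 0<s _ q∣2s-r s≤ =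
  Conclusion-cong p q r s e≡ a≡ e-a≡ S₂≡ (≤-trans 0<s (m≤n+m s _) , N<q^e-1 , C-value)
  where
  a' : ℕ
  a' = a ∸ 1
  T' : ℕ
  T' = e ∸ a ∸ 1
  a≡ : a ≡ suc a'
  a≡ = sym (m+[n∸m]≡n (≤-trans (s≤s z≤n) 2≤a))
  e-a≡ : e ∸ a ≡ suc T'
  e-a≡ = sym (m+[n∸m]≡n (≤-trans (s≤s z≤n) (m+n≤o⇒m≤o∸n 2 (subst (_≤ e) (+-comm a 2) a+2≤e))))
  e≡ : e ≡ suc a' + suc T'
  e≡ = trans (sym (m+[n∸m]≡n (≤-trans (m≤m+n a 2) a+2≤e))) (cong₂ _+_ a≡ e-a≡)
  m : ℕ
  m = proj₁ (halving-condition q r s r<q q∣2s-r)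
  2s≡r+qm : 2 * s ≡ r + q * m
  2s≡r+qm = proj₂ (halving-condition q r s r<q q∣2s-r)
  S₂≡ : (2 * r * q ^ (e ∸ a) + 2 * s ∸ r) / q ≡ 2 * r * q ^ T' + m
  S₂≡ = trans (cong (λ t → (2 * r * q ^ t + 2 * s ∸ r) / q) e-a≡) (S₂-formula q r s (q ^ T') m 2s≡r+qm)
  open Lemma6-1 p k q prime q≡p^k (subst (3 ≤_) (sym q≡p^k) (3≤p^k p k prime p≢2 1≤k)) a' T' r s m (∸-monoˡ-≤ 1 2≤a) 0<r r<q 2s≡r+qm s≤
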